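{- For $|q|<1$, \[ \sum_{n = 1}^\infty \left(\sum_{\pi \in \mathcal{D}(n)} (-1)^{\# (\pi)+s(\pi)}s(\pi)\right) q^n=\sum_{n=1}^{\infty}\frac{(-1)^{n-1}q^{n(n+1)/2}}{(q;q)_{n-1}(1+q^n)^2}=\frac{(q;q)_\infty}{(-q;q)_\infty}\sum_{n=1}^{\infty}\frac{q^{n}}{1+q^{n}}. \]
   Context: $\mathcal{D}(n)$ denotes the set of partitions of $n$ into distinct parts; for $\pi\in\mathcal{D}(n)$, $\#(\pi)$ is the number of parts and $s(\pi)$ is the smallest part. Here $(a;q)_n=(1-a)\cdots(1-aq^{n-1})$, $(a;q)_0=1$, $(a;q)_\infty=\prod_{j\ge0}(1-aq^j)$. -}

module Defs where

open import Data.Nat as ℕ using (ℕ; zero; suc; _∸_; _<ᵇ_; NonZero; _≟_)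
open import Data.Nat.DivMod using (_/_; _%_)
open import Data.Integer using (ℤ; +_; -_; _+_; _*_; _-_)
open import Data.List using (List; []; _∷_; _++_; map; filter; downFrom; length; foldr)
open import Data.Bool using (if_then_else_)

-- Formal power series in q with integer coefficients: ℤ[[q]].
-- The analytic identity for |q|<1 between convergent power series is
-- equivalent to coefficientwise equality in ℤ[[q]].

FPS : Set
FPS = ℕ → ℤ

sumTo : (ℕ → ℤ) → ℕ → ℤ
sumTo f zero    = f zero
sumTo f (suc k) = sumTo f k + f (suc k)

sign : ℕ → ℤ
sign zero    = + 1
sign (suc k) = - sign k

zpow : ℤ → ℕ → ℤ
zpow a zero    = + 1
zpow a (suc m) = a * zpow a m

one : FPS
one zero    = + 1
one (suc _) = + 0

_⊛_ : FPS → FPS → FPS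
(f ⊛ g) k = sumTo (λ i → f i * g (k ∸ i)) k
infixl 7 _⊛_

_·_ : ℤ → FPS → FPS
(c · f) k = c * f k

shift : ℕ → FPS → FPS
shift m f k = if k <ᵇ m then + 0 else f (k ∸ m)

-- 1 - a q^j  (j ≥ 1)
oneMinus : ℤ → ℕ → FPS
oneMinus a j k = if ⌊ k ≟ 0 ⌋' then + 1 else (if ⌊ k ≟ j ⌋' then - a else + 0)
  where
  open import Relation.Nullary.Decidable using (⌊_⌋)
  ⌊_⌋' = ⌊_⌋

-- 1 / (1 - a q^j) = Σ_m a^m q^{jm}   (j ≥ 1), the inverse of oneMinus a j in ℤ[[q]]
geomInv : ℤ → (j : ℕ) → .{{NonZero j}} → FPS
geomInv a j k = if ⌊ k % j ≟ 0 ⌋' then zpow a (k / j) else + 0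
  where
  open import Relation.Nullary.Decidable using (⌊_⌋)
  ⌊_⌋' = ⌊_⌋

prod : (ℕ → FPS) → ℕ → FPS
prod F zero    = one
prod F (suc m) = prod F m ⊛ F m

qPoch : ℕ → FPS
qPoch m = prod (λ i → oneMinus (+ 1) (suc i)) m

qPochInv : ℕ → FPS
qPochInv m = prod (λ i → geomInv (+ 1) (suc i)) m

-- (q;q)_∞ : coefficient of q^k only involves the factors with j ≤ k
qPochInf : FPS
qPochInf k = qPoch k k

-- 1/(-q;q)_∞ = Π_{j≥1} 1/(1 + q^j) : coefficient of q^k only involves j ≤ k
negqPochInfInv : FPS
negqPochInfInv k = prod (λ i → geomInv (- + 1) (suc i)) k k

-- Partitions into distinct parts.
-- A partition into distinct parts is represented as the strictly
-- decreasing list of its parts.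

sublists : List ℕ → List (List ℕ)
sublists []       = [] ∷ []
sublists (x ∷ xs) = map (x ∷_) (sublists xs) ++ sublists xs

listSum : List ℕ → ℕ
listSum = foldr ℕ._+_ 0

𝒟 : ℕ → List (List ℕ)
𝒟 n = filter (λ π → listSum π ≟ n) (sublists (map suc (downFrom n)))

#parts : List ℕ → ℕ
#parts = length

-- s(π): smallest part (0 for the empty partition, never used for n ≥ 1)
smallest : List ℕ → ℕ
smallest []           = 0
smallest (x ∷ [])     = x
smallest (x ∷ y ∷ ys) = ℕ._⊓_ x (smallest (y ∷ ys))

sumOver : List (List ℕ) → (List ℕ → ℤ) → ℤ
sumOver πs f = foldr (λ π acc → f π + acc) (+ 0) πs

lhsSeries : FPS
lhsSeries zero    = + 0
lhsSeries (suc k) =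
  sumOver (𝒟 (suc k)) (λ π → sign (#parts π ℕ.+ smallest π) * + smallest π)

-- the n-th summand (n = suc m) of the middle series:
-- (-1)^{n-1} q^{n(n+1)/2} / ((q;q)_{n-1} (1+q^n)^2)
midTerm : ℕ → FPS
midTerm m =
  sign m · shift ((suc m ℕ.* suc (suc m)) / 2)
     (qPochInv m ⊛ geomInv (- + 1) (suc m) ⊛ geomInv (- + 1) (suc m))

-- Σ_{n≥1} midTerm; the n-th term has order ≥ n(n+1)/2 ≥ n, so only
-- n ≤ k contribute to the coefficient of q^k.
midSeries : FPS
midSeries k = sumTo (λ m → midTerm m k) k

-- Σ_{n≥1} q^n/(1+q^n); the n-th term has order n.
lambertSeries : FPS
lambertSeries k = sumTo (λ m → shift (suc m) (geomInv (- + 1) (suc m)) k) k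

rhsSeries : FPS
rhsSeries = qPochInf ⊛ negqPochInfInv ⊛ lambertSeries

-- All three series equal S = Σ_(x≥0) (-1)^x (x+1) q^(x+1) (q^(x+2);q)_∞, computed in ℤ[[q]] where
-- infinite sums and products are truncated coefficientwise.
--
-- Left: the weighted generating function D_N of partitions into distinct parts ≤ N satisfies
-- D_N = (1 - q^N) D_(N-1) + (-1)^(N+1) N q^N, and this makes S - D_N (q^(N+1);q)_∞ = O(q^(N+1)).
--
-- Middle: expand (q^(x+2);q)_∞ by Euler's identity Σ_m (-1)^m q^(m(m+1)/2 + m(x+1)) / (q;q)_m,
-- exchange the two sums, and use Σ_x (-1)^x (x+1) q^((x+1)n) = q^n / (1 + q^n)^2.
--
-- Right: with z = q^(t+1), the series W_t = Σ_x (-1)^x z^x (q^(x+1);q)_∞ and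
-- S_t = Σ_x (-1)^x (x+1) z^(x+1) (q^(x+2);q)_∞ (so S = S_0) satisfy (1 + z) W_t = W_(t+1) and
-- (1 + z) S_t = S_(t+1) + z W_t. So do (q;q)_∞/(-z;q)_∞ and its product with Σ_(n>t) q^n/(1+q^n).
-- A family solving such a recursion is determined by the coefficients of q^0, …, q^t of its t-th
-- member, since the coefficients below q^n of the t-th member only depend on those of the (t+1)-st.

module Submission where

open import Defs
open import Data.Bool using (true; false; if_then_else_)
open import Data.Empty using (⊥-elim)
open import Data.Integer using (ℤ; +_; -_; _+_; _*_; _-_; 0ℤ)
import Data.Integer.Properties as ℤₚ
open import Data.Integer.Tactic.RingSolver using (solve-∀)
open import Data.List using (List; []; _∷_; _++_; map; filter; downFrom)
open import Data.List.Relation.Unary.All as All using (All; []; _∷_)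
import Data.List.Relation.Unary.All.Properties as Allₚ
open import Data.Nat as ℕ using (ℕ; zero; suc; _∸_; _≤_; _<_; z≤n; s≤s; _<?_; _<ᵇ_)
open import Data.Nat.DivMod using (_/_; _%_; m*n/n≡m; m<n⇒m%n≡m; m≤n⇒[n∸m]%m≡n%m; m/n≡1+[m∸n]/n)
import Data.Nat.Properties as ℕₚ
import Data.Nat.Tactic.RingSolver as ℕSolver
open import Data.Product using (_×_; _,_)
open import Function using (_∘_)
open import Function.Bundles using (mk⇔)
open import Relation.Binary.Definitions using (tri<; tri≈; tri>)
open import Relation.Binary.PropositionalEquality
import Relation.Binary.Reasoning.Setoid as SetoidReasoning
open import Relation.Nullary using (yes; no; does)
open import Relation.Nullary.Decidable using (⌊_⌋; dec-false; does-⇔)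

sumTo-cong : ∀ {f g} n → (∀ i → i ≤ n → f i ≡ g i) → sumTo f n ≡ sumTo g n
sumTo-cong zero    f≡g = f≡g 0 z≤n
sumTo-cong (suc n) f≡g =
  cong₂ _+_ (sumTo-cong n (λ i i≤n → f≡g i (ℕₚ.m≤n⇒m≤1+n i≤n))) (f≡g (suc n) ℕₚ.≤-refl)

sumTo-ext : ∀ {f g} n → f ≗ g → sumTo f n ≡ sumTo g n
sumTo-ext n f≗g = sumTo-cong n (λ i _ → f≗g i)

sumTo-zero : ∀ {f} n → (∀ i → i ≤ n → f i ≡ 0ℤ) → sumTo f n ≡ 0ℤ
sumTo-zero n f≡0 = trans (sumTo-cong n f≡0) (sumTo-const n)
  where
  sumTo-const : ∀ n → sumTo (λ _ → 0ℤ) n ≡ 0ℤ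
  sumTo-const zero    = refl
  sumTo-const (suc n) = cong (_+ 0ℤ) (sumTo-const n)

sumTo-distrib-+ : ∀ f g n → sumTo (λ i → f i + g i) n ≡ sumTo f n + sumTo g n
sumTo-distrib-+ f g zero    = refl
sumTo-distrib-+ f g (suc n) =
  trans (cong (_+ (f (suc n) + g (suc n))) (sumTo-distrib-+ f g n))
        (interchange (sumTo f n) (sumTo g n) (f (suc n)) (g (suc n)))
  where
  interchange : ∀ a b c d → (a + b) + (c + d) ≡ (a + c) + (b + d)
  interchange = solve-∀

sumTo-distrib-- : ∀ f g n → sumTo (λ i → f i - g i) n ≡ sumTo f n - sumTo g n
sumTo-distrib-- f g zero    = refl
sumTo-distrib-- f g (suc n) =
  trans (cong (_+ (f (suc n) - g (suc n))) (sumTo-distrib-- f g n))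
        (interchange (sumTo f n) (sumTo g n) (f (suc n)) (g (suc n)))
  where
  interchange : ∀ a b c d → (a - b) + (c - d) ≡ (a + c) - (b + d)
  interchange = solve-∀

sumTo-*ˡ : ∀ c f n → sumTo (λ i → c * f i) n ≡ c * sumTo f n
sumTo-*ˡ c f zero    = refl
sumTo-*ˡ c f (suc n) =
  trans (cong (_+ (c * f (suc n))) (sumTo-*ˡ c f n)) (sym (ℤₚ.*-distribˡ-+ c (sumTo f n) (f (suc n))))

sumTo-*ʳ : ∀ c f n → sumTo (λ i → f i * c) n ≡ sumTo f n * c
sumTo-*ʳ c f n =
  trans (sumTo-ext n (λ i → ℤₚ.*-comm (f i) c)) (trans (sumTo-*ˡ c f n) (ℤₚ.*-comm c _))

sumTo-unfoldˡ : ∀ f n → sumTo f (suc n) ≡ f 0 + sumTo (f ∘ suc) n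
sumTo-unfoldˡ f zero    = refl
sumTo-unfoldˡ f (suc n) =
  trans (cong (_+ f (suc (suc n))) (sumTo-unfoldˡ f n)) (ℤₚ.+-assoc (f 0) _ _)

sumTo-swap : ∀ (F : ℕ → ℕ → ℤ) m n →
             sumTo (λ i → sumTo (F i) n) m ≡ sumTo (λ j → sumTo (λ i → F i j) m) n
sumTo-swap F zero    n = refl
sumTo-swap F (suc m) n =
  trans (cong (_+ sumTo (F (suc m)) n) (sumTo-swap F m n))
        (sym (sumTo-distrib-+ (λ j → sumTo (λ i → F i j) m) (F (suc m)) n))

sumTo-reverse : ∀ f n → sumTo f n ≡ sumTo (λ i → f (n ∸ i)) n
sumTo-reverse f zero    = refl
sumTo-reverse f (suc n) = begin
  sumTo f n + f (suc n)                  ≡⟨ cong (_+ f (suc n)) (sumTo-reverse f n) ⟩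
  sumTo (λ i → f (n ∸ i)) n + f (suc n)  ≡⟨ ℤₚ.+-comm _ (f (suc n)) ⟩
  f (suc n) + sumTo (λ i → f (n ∸ i)) n  ≡⟨ sym (sumTo-unfoldˡ (λ i → f (suc n ∸ i)) n) ⟩
  sumTo (λ i → f (suc n ∸ i)) (suc n)    ∎
  where open ≡-Reasoning

sumTo-dropˡ : ∀ m n f → (∀ i → i < m → f i ≡ 0ℤ) → sumTo f (m ℕ.+ n) ≡ sumTo (λ j → f (m ℕ.+ j)) n
sumTo-dropˡ zero    n f f≡0 = refl
sumTo-dropˡ (suc m) n f f≡0 = begin
  sumTo f (suc (m ℕ.+ n))                   ≡⟨ sumTo-unfoldˡ f (m ℕ.+ n) ⟩
  f 0 + sumTo (f ∘ suc) (m ℕ.+ n)           ≡⟨ cong₂ _+_ (f≡0 0 (s≤s z≤n))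
                                                 (sumTo-dropˡ m n (f ∘ suc) (λ i i<m → f≡0 (suc i) (s≤s i<m))) ⟩
  0ℤ + sumTo (λ j → f (suc m ℕ.+ j)) n      ≡⟨ ℤₚ.+-identityˡ _ ⟩
  sumTo (λ j → f (suc m ℕ.+ j)) n           ∎
  where open ≡-Reasoning

sumTo-extend : ∀ {n m} f → n ≤ m → (∀ i → n < i → f i ≡ 0ℤ) → sumTo f m ≡ sumTo f n
sumTo-extend {n} {m} f n≤m f≡0 =
  trans (cong (sumTo f) (sym (ℕₚ.m+[n∸m]≡n n≤m))) (extend (m ∸ n))
  where
  extend : ∀ d → sumTo f (n ℕ.+ d) ≡ sumTo f n
  extend zero    = cong (sumTo f) (ℕₚ.+-identityʳ n)
  extend (suc d) = begin
    sumTo f (n ℕ.+ suc d)                  ≡⟨ cong (sumTo f) (ℕₚ.+-suc n d) ⟩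
    sumTo f (n ℕ.+ d) + f (suc (n ℕ.+ d))  ≡⟨ cong₂ _+_ (extend d) (f≡0 _ (s≤s (ℕₚ.m≤m+n n d))) ⟩
    sumTo f n + 0ℤ                         ≡⟨ ℤₚ.+-identityʳ _ ⟩
    sumTo f n                              ∎
    where open ≡-Reasoning

sumTo-triangle : ∀ (F : ℕ → ℕ → ℤ) k →
                 sumTo (λ a → sumTo (λ i → F i a) a) k ≡
                 sumTo (λ i → sumTo (λ b → F i (i ℕ.+ b)) (k ∸ i)) k
sumTo-triangle F zero    = refl
sumTo-triangle F (suc k) = begin
  sumTo (λ a → sumTo (λ i → F i a) a) k + sumTo (λ i → F i (suc k)) (suc k)
    ≡⟨ cong (_+ sumTo (λ i → F i (suc k)) (suc k)) (sumTo-triangle F k) ⟩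
  sumTo (λ i → row i (k ∸ i)) k + (sumTo (λ i → F i (suc k)) k + F (suc k) (suc k))
    ≡⟨ sym (ℤₚ.+-assoc (sumTo (λ i → row i (k ∸ i)) k) _ _) ⟩
  (sumTo (λ i → row i (k ∸ i)) k + sumTo (λ i → F i (suc k)) k) + F (suc k) (suc k)
    ≡⟨ cong₂ _+_ (sym (sumTo-distrib-+ (λ i → row i (k ∸ i)) (λ i → F i (suc k)) k))
                 (cong (F (suc k)) (sym (ℕₚ.+-identityʳ (suc k)))) ⟩
  sumTo (λ i → row i (k ∸ i) + F i (suc k)) k + row (suc k) 0
    ≡⟨ cong₂ _+_ (sumTo-cong k row-extend) (cong (row (suc k)) (sym (ℕₚ.n∸n≡0 k))) ⟩
  sumTo (λ i → row i (suc k ∸ i)) k + row (suc k) (k ∸ k) ∎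
  where
  open ≡-Reasoning
  row : ℕ → ℕ → ℤ
  row i m = sumTo (λ b → F i (i ℕ.+ b)) m
  row-extend : ∀ i → i ≤ k → row i (k ∸ i) + F i (suc k) ≡ row i (suc k ∸ i)
  row-extend i i≤k = begin
    row i (k ∸ i) + F i (suc k)                ≡⟨ cong (λ a → row i (k ∸ i) + F i a) (sym i+[1+k∸i]≡1+k) ⟩
    row i (k ∸ i) + F i (i ℕ.+ suc (k ∸ i))    ≡⟨ cong (row i) (sym (ℕₚ.+-∸-assoc 1 i≤k)) ⟩
    row i (suc k ∸ i)                          ∎
    where
    i+[1+k∸i]≡1+k : i ℕ.+ suc (k ∸ i) ≡ suc k
    i+[1+k∸i]≡1+k = trans (ℕₚ.+-suc i (k ∸ i)) (cong suc (ℕₚ.m+[n∸m]≡n i≤k))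

module ≗-Reasoning = SetoidReasoning (ℕ →-setoid ℤ)

≗-refl : ∀ {f : FPS} → f ≗ f
≗-refl _ = refl

≗-sym : ∀ {f g : FPS} → f ≗ g → g ≗ f
≗-sym f≗g k = sym (f≗g k)

≗-trans : ∀ {f g h : FPS} → f ≗ g → g ≗ h → f ≗ h
≗-trans f≗g g≗h k = trans (f≗g k) (g≗h k)

𝟘 : FPS
𝟘 _ = 0ℤ

infixl 6 _⊕_ _⊖_

_⊕_ : FPS → FPS → FPS
(f ⊕ g) k = f k + g k

_⊖_ : FPS → FPS → FPS
(f ⊖ g) k = f k - g k

⊕-cong : ∀ {f f′ g g′} → f ≗ f′ → g ≗ g′ → f ⊕ g ≗ f′ ⊕ g′
⊕-cong f≗f′ g≗g′ k = cong₂ _+_ (f≗f′ k) (g≗g′ k)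

⊖-cong : ∀ {f f′ g g′} → f ≗ f′ → g ≗ g′ → f ⊖ g ≗ f′ ⊖ g′
⊖-cong f≗f′ g≗g′ k = cong₂ _-_ (f≗f′ k) (g≗g′ k)

·-cong : ∀ c {f f′} → f ≗ f′ → c · f ≗ c · f′
·-cong c f≗f′ k = cong (c *_) (f≗f′ k)

⊕-congˡ : ∀ f {g g′} → g ≗ g′ → f ⊕ g ≗ f ⊕ g′
⊕-congˡ f = ⊕-cong (≗-refl {f})

⊕-congʳ : ∀ g {f f′} → f ≗ f′ → f ⊕ g ≗ f′ ⊕ g
⊕-congʳ g f≗f′ = ⊕-cong f≗f′ (≗-refl {g})

⊖-congˡ : ∀ f {g g′} → g ≗ g′ → f ⊖ g ≗ f ⊖ g′
⊖-congˡ f = ⊖-cong (≗-refl {f})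

⊕-comm : ∀ f g → f ⊕ g ≗ g ⊕ f
⊕-comm f g k = ℤₚ.+-comm (f k) (g k)

⊕-assoc : ∀ f g h → (f ⊕ g) ⊕ h ≗ f ⊕ (g ⊕ h)
⊕-assoc f g h k = ℤₚ.+-assoc (f k) (g k) (h k)

·-identityˡ : ∀ f → (+ 1) · f ≗ f
·-identityˡ f k = ℤₚ.*-identityˡ (f k)

⊛-cong : ∀ {f f′ g g′} → f ≗ f′ → g ≗ g′ → f ⊛ g ≗ f′ ⊛ g′
⊛-cong f≗f′ g≗g′ k = sumTo-ext k (λ i → cong₂ _*_ (f≗f′ i) (g≗g′ (k ∸ i)))

⊛-congˡ : ∀ f {g g′} → g ≗ g′ → f ⊛ g ≗ f ⊛ g′
⊛-congˡ f = ⊛-cong (≗-refl {f})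

⊛-congʳ : ∀ g {f f′} → f ≗ f′ → f ⊛ g ≗ f′ ⊛ g
⊛-congʳ g f≗f′ = ⊛-cong f≗f′ (≗-refl {g})

⊛-comm : ∀ f g → f ⊛ g ≗ g ⊛ f
⊛-comm f g k = begin
  sumTo (λ i → f i * g (k ∸ i)) k              ≡⟨ sumTo-reverse (λ i → f i * g (k ∸ i)) k ⟩
  sumTo (λ i → f (k ∸ i) * g (k ∸ (k ∸ i))) k  ≡⟨ sumTo-cong k swap ⟩
  sumTo (λ i → g i * f (k ∸ i)) k              ∎
  where
  open ≡-Reasoning
  swap : ∀ i → i ≤ k → f (k ∸ i) * g (k ∸ (k ∸ i)) ≡ g i * f (k ∸ i)
  swap i i≤k = trans (cong (λ j → f (k ∸ i) * g j) (ℕₚ.m∸[m∸n]≡n i≤k)) (ℤₚ.*-comm (f (k ∸ i)) (g i))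

⊛-assoc : ∀ f g h → (f ⊛ g) ⊛ h ≗ f ⊛ (g ⊛ h)
⊛-assoc f g h k = begin
  sumTo (λ a → sumTo (λ i → f i * g (a ∸ i)) a * h (k ∸ a)) k
    ≡⟨ sumTo-ext k (λ a → sym (sumTo-*ʳ (h (k ∸ a)) (λ i → f i * g (a ∸ i)) a)) ⟩
  sumTo (λ a → sumTo (λ i → f i * g (a ∸ i) * h (k ∸ a)) a) k
    ≡⟨ sumTo-triangle (λ i a → f i * g (a ∸ i) * h (k ∸ a)) k ⟩
  sumTo (λ i → sumTo (λ b → f i * g (i ℕ.+ b ∸ i) * h (k ∸ (i ℕ.+ b))) (k ∸ i)) k
    ≡⟨ sumTo-ext k (λ i → sumTo-ext (k ∸ i) (reindex i)) ⟩
  sumTo (λ i → sumTo (λ b → f i * (g b * h (k ∸ i ∸ b))) (k ∸ i)) k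
    ≡⟨ sumTo-ext k (λ i → sumTo-*ˡ (f i) (λ b → g b * h (k ∸ i ∸ b)) (k ∸ i)) ⟩
  sumTo (λ i → f i * sumTo (λ b → g b * h (k ∸ i ∸ b)) (k ∸ i)) k ∎
  where
  open ≡-Reasoning
  reindex : ∀ i b → f i * g (i ℕ.+ b ∸ i) * h (k ∸ (i ℕ.+ b)) ≡ f i * (g b * h (k ∸ i ∸ b))
  reindex i b = trans (cong₂ (λ u v → f i * g u * h v) (ℕₚ.m+n∸m≡n i b) (sym (ℕₚ.∸-+-assoc k i b)))
                      (ℤₚ.*-assoc (f i) (g b) (h (k ∸ i ∸ b)))

⊛-exchange : ∀ f g h → f ⊛ (g ⊛ h) ≗ g ⊛ (f ⊛ h)
⊛-exchange f g h = begin
  f ⊛ (g ⊛ h)   ≈⟨ ≗-sym (⊛-assoc f g h) ⟩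
  (f ⊛ g) ⊛ h   ≈⟨ ⊛-congʳ h (⊛-comm f g) ⟩
  (g ⊛ f) ⊛ h   ≈⟨ ⊛-assoc g f h ⟩
  g ⊛ (f ⊛ h)   ∎
  where open ≗-Reasoning

⊛-distribˡ-⊕ : ∀ f g h → f ⊛ (g ⊕ h) ≗ f ⊛ g ⊕ f ⊛ h
⊛-distribˡ-⊕ f g h k =
  trans (sumTo-ext k (λ i → ℤₚ.*-distribˡ-+ (f i) (g (k ∸ i)) (h (k ∸ i)))) (sumTo-distrib-+ _ _ k)

⊛-distribʳ-⊕ : ∀ f g h → (f ⊕ g) ⊛ h ≗ f ⊛ h ⊕ g ⊛ h
⊛-distribʳ-⊕ f g h k =
  trans (sumTo-ext k (λ i → ℤₚ.*-distribʳ-+ (h (k ∸ i)) (f i) (g i))) (sumTo-distrib-+ _ _ k)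

⊛-distribˡ-⊖ : ∀ f g h → f ⊛ (g ⊖ h) ≗ f ⊛ g ⊖ f ⊛ h
⊛-distribˡ-⊖ f g h k =
  trans (sumTo-ext k (λ i → distrib (f i) (g (k ∸ i)) (h (k ∸ i)))) (sumTo-distrib-- _ _ k)
  where
  distrib : ∀ a b c → a * (b - c) ≡ a * b - a * c
  distrib = solve-∀

·-⊛ : ∀ c f g → (c · f) ⊛ g ≗ c · (f ⊛ g)
·-⊛ c f g k = trans (sumTo-ext k (λ i → ℤₚ.*-assoc c (f i) (g (k ∸ i)))) (sumTo-*ˡ c _ k)

⊛-· : ∀ c f g → f ⊛ (c · g) ≗ c · (f ⊛ g)
⊛-· c f g k = trans (sumTo-ext k (λ i → exchange (f i) c (g (k ∸ i)))) (sumTo-*ˡ c _ k)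
  where
  exchange : ∀ a b d → a * (b * d) ≡ b * (a * d)
  exchange = solve-∀

⊛-identityˡ : ∀ f → one ⊛ f ≗ f
⊛-identityˡ f zero    = ℤₚ.*-identityˡ (f 0)
⊛-identityˡ f (suc k) = begin
  sumTo (λ i → one i * f (suc k ∸ i)) (suc k)             ≡⟨ sumTo-unfoldˡ _ k ⟩
  + 1 * f (suc k) + sumTo (λ i → 0ℤ * f (k ∸ i)) k        ≡⟨ cong₂ _+_ (ℤₚ.*-identityˡ (f (suc k)))
                                                               (sumTo-zero k (λ i _ → ℤₚ.*-zeroˡ (f (k ∸ i)))) ⟩
  f (suc k) + 0ℤ                                          ≡⟨ ℤₚ.+-identityʳ _ ⟩
  f (suc k)                                               ∎
  where open ≡-Reasoning

⊛-identityʳ : ∀ f → f ⊛ one ≗ f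
⊛-identityʳ f = ≗-trans (⊛-comm f one) (⊛-identityˡ f)

shift-< : ∀ {m k} f → k < m → shift m f k ≡ 0ℤ
shift-< {m} {k} f k<m with k <ᵇ m | ℕₚ.<⇒<ᵇ k<m
... | true | _ = refl

shift-≥ : ∀ {m k} f → m ≤ k → shift m f k ≡ f (k ∸ m)
shift-≥ {m} {k} f m≤k with k <ᵇ m | ℕₚ.<ᵇ⇒< k m
... | false | _   = refl
... | true  | k<m = ⊥-elim (ℕₚ.<⇒≱ (k<m _) m≤k)

shift-congˡ : ∀ {m n} f → m ≡ n → shift m f ≗ shift n f
shift-congˡ f refl = ≗-refl

shift-congʳ : ∀ m {f g} → f ≗ g → shift m f ≗ shift m g
shift-congʳ m {f} {g} f≗g k with k <? m
... | yes k<m = trans (shift-< f k<m) (sym (shift-< g k<m))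
... | no k≮m  = trans (shift-≥ f m≤k) (trans (f≗g (k ∸ m)) (sym (shift-≥ g m≤k)))
  where m≤k = ℕₚ.≮⇒≥ k≮m

shift-pointwise₂ : ∀ m (_∙_ : ℤ → ℤ → ℤ) → 0ℤ ∙ 0ℤ ≡ 0ℤ →
                   ∀ f g → shift m (λ k → f k ∙ g k) ≗ λ k → shift m f k ∙ shift m g k
shift-pointwise₂ m _∙_ 0∙0≡0 f g k with k <? m
... | yes k<m = trans (shift-< f∙g k<m) (sym (trans (cong₂ _∙_ (shift-< f k<m) (shift-< g k<m)) 0∙0≡0))
  where f∙g = λ k → f k ∙ g k
... | no k≮m  = trans (shift-≥ f∙g m≤k) (sym (cong₂ _∙_ (shift-≥ f m≤k) (shift-≥ g m≤k)))
  where
  m≤k = ℕₚ.≮⇒≥ k≮m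
  f∙g = λ k → f k ∙ g k

shift-⊖ : ∀ m f g → shift m (f ⊖ g) ≗ shift m f ⊖ shift m g
shift-⊖ m = shift-pointwise₂ m _-_ refl

shift-· : ∀ m c f → shift m (c · f) ≗ c · shift m f
shift-· m c f = shift-pointwise₂ m (λ _ a → c * a) (ℤₚ.*-zeroʳ c) f f

shift-shift : ∀ m n f → shift m (shift n f) ≗ shift (m ℕ.+ n) f
shift-shift m n f k with k <? m
... | yes k<m = trans (shift-< (shift n f) k<m) (sym (shift-< f (ℕₚ.<-≤-trans k<m (ℕₚ.m≤m+n m n))))
... | no k≮m with k ∸ m <? n
...   | yes k∸m<n = trans (shift-≥ (shift n f) m≤k) (trans (shift-< f k∸m<n) (sym (shift-< f k<m+n)))
  where
  m≤k = ℕₚ.≮⇒≥ k≮m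
  k<m+n : k < m ℕ.+ n
  k<m+n = subst (_< m ℕ.+ n) (ℕₚ.m+[n∸m]≡n m≤k) (ℕₚ.+-monoʳ-< m k∸m<n)
...   | no k∸m≮n = begin
  shift m (shift n f) k  ≡⟨ shift-≥ (shift n f) m≤k ⟩
  shift n f (k ∸ m)      ≡⟨ shift-≥ f (ℕₚ.≮⇒≥ k∸m≮n) ⟩
  f (k ∸ m ∸ n)          ≡⟨ cong f (ℕₚ.∸-+-assoc k m n) ⟩
  f (k ∸ (m ℕ.+ n))      ≡⟨ sym (shift-≥ f m+n≤k) ⟩
  shift (m ℕ.+ n) f k    ∎
  where
  open ≡-Reasoning
  m≤k = ℕₚ.≮⇒≥ k≮m
  m+n≤k : m ℕ.+ n ≤ k
  m+n≤k = subst (m ℕ.+ n ≤_) (ℕₚ.m+[n∸m]≡n m≤k) (ℕₚ.+-monoʳ-≤ m (ℕₚ.≮⇒≥ k∸m≮n))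

shift-·-shift : ∀ m c n f → shift m (c · shift n f) ≗ c · shift (m ℕ.+ n) f
shift-·-shift m c n f k = trans (shift-· m c (shift n f) k) (cong (c *_) (shift-shift m n f k))

shift-⊛ : ∀ m f g → shift m f ⊛ g ≗ shift m (f ⊛ g)
shift-⊛ m f g k with k <? m
... | yes k<m =
  trans (sumTo-zero k (λ i i≤k → vanish i (ℕₚ.≤-<-trans i≤k k<m))) (sym (shift-< (f ⊛ g) k<m))
  where
  vanish : ∀ i → i < m → shift m f i * g (k ∸ i) ≡ 0ℤ
  vanish i i<m = trans (cong (_* g (k ∸ i)) (shift-< f i<m)) (ℤₚ.*-zeroˡ (g (k ∸ i)))
... | no k≮m = begin
  sumTo (λ i → shift m f i * g (k ∸ i)) k                  ≡⟨ cong (sumTo _) (sym (ℕₚ.m+[n∸m]≡n m≤k)) ⟩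
  sumTo (λ i → shift m f i * g (k ∸ i)) (m ℕ.+ (k ∸ m))    ≡⟨ sumTo-dropˡ m (k ∸ m) _ vanish ⟩
  sumTo (λ j → shift m f (m ℕ.+ j) * g (k ∸ (m ℕ.+ j))) (k ∸ m)
    ≡⟨ sumTo-ext (k ∸ m) (λ j → cong₂ _*_ (trans (shift-≥ f (ℕₚ.m≤m+n m j)) (cong f (ℕₚ.m+n∸m≡n m j)))
                                           (cong g (sym (ℕₚ.∸-+-assoc k m j)))) ⟩
  sumTo (λ j → f j * g (k ∸ m ∸ j)) (k ∸ m)                ≡⟨ sym (shift-≥ (f ⊛ g) m≤k) ⟩
  shift m (f ⊛ g) k                                        ∎
  where
  open ≡-Reasoning
  m≤k = ℕₚ.≮⇒≥ k≮m
  vanish : ∀ i → i < m → shift m f i * g (k ∸ i) ≡ 0ℤ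
  vanish i i<m = trans (cong (_* g (k ∸ i)) (shift-< f i<m)) (ℤₚ.*-zeroˡ (g (k ∸ i)))

⊛-shift : ∀ m f g → f ⊛ shift m g ≗ shift m (f ⊛ g)
⊛-shift m f g = ≗-trans (⊛-comm f (shift m g)) (≗-trans (shift-⊛ m g f) (shift-congʳ m (⊛-comm g f)))

shift-≗-⊛ : ∀ m f → shift m f ≗ f ⊛ shift m one
shift-≗-⊛ m f = ≗-sym (≗-trans (⊛-shift m f one) (shift-congʳ m (⊛-identityʳ f)))

shift-⊖-shift : ∀ e s {f g} → f ≗ g ⊖ shift s g → shift e f ≗ shift e g ⊖ shift (e ℕ.+ s) g
shift-⊖-shift e s {f} {g} f≗g = ≗-trans (shift-congʳ e f≗g)
  (≗-trans (shift-⊖ e g (shift s g)) (⊖-congˡ (shift e g) (shift-shift e s g)))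

infix 4 _≈[<_]_

_≈[<_]_ : FPS → ℕ → FPS → Set
f ≈[< n ] g = ∀ k → k < n → f k ≡ g k

≈[<]-weaken : ∀ {m n f g} → m ≤ n → f ≈[< n ] g → f ≈[< m ] g
≈[<]-weaken m≤n f≈g k k<m = f≈g k (ℕₚ.<-≤-trans k<m m≤n)

≈[<]-trans : ∀ {n f g h} → f ≈[< n ] g → g ≈[< n ] h → f ≈[< n ] h
≈[<]-trans f≈g g≈h k k<n = trans (f≈g k k<n) (g≈h k k<n)

≈[<]-sym : ∀ {n f g} → f ≈[< n ] g → g ≈[< n ] f
≈[<]-sym f≈g k k<n = sym (f≈g k k<n)

⊛-congˡ-below : ∀ {n} f {g g′} → g ≈[< n ] g′ → f ⊛ g ≈[< n ] f ⊛ g′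
⊛-congˡ-below f g≈g′ k k<n =
  sumTo-ext k (λ i → cong (f i *_) (g≈g′ (k ∸ i) (ℕₚ.≤-<-trans (ℕₚ.m∸n≤m k i) k<n)))

⊛-orderˡ : ∀ {n} f g → f ≈[< n ] 𝟘 → f ⊛ g ≈[< n ] 𝟘
⊛-orderˡ f g f≈0 k k<n = sumTo-zero k vanish
  where
  vanish : ∀ i → i ≤ k → f i * g (k ∸ i) ≡ 0ℤ
  vanish i i≤k = trans (cong (_* g (k ∸ i)) (f≈0 i (ℕₚ.≤-<-trans i≤k k<n))) (ℤₚ.*-zeroˡ (g (k ∸ i)))

⊛-orderʳ : ∀ {n} f g → g ≈[< n ] 𝟘 → f ⊛ g ≈[< n ] 𝟘
⊛-orderʳ f g g≈0 k k<n = trans (⊛-comm f g k) (⊛-orderˡ g f g≈0 k k<n)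

⊛-identityʳ-below : ∀ {n} f h → h ≈[< n ] one → f ⊛ h ≈[< n ] f
⊛-identityʳ-below f h h≈1 k k<n = trans (⊛-congˡ-below f h≈1 k k<n) (⊛-identityʳ f k)

·-order : ∀ {n} c f → f ≈[< n ] 𝟘 → c · f ≈[< n ] 𝟘
·-order c f f≈0 k k<n = trans (cong (c *_) (f≈0 k k<n)) (ℤₚ.*-zeroʳ c)

shift-order₀ : ∀ m f → shift m f ≈[< m ] 𝟘
shift-order₀ m f k = shift-< f

shift-order : ∀ {n} m f → f ≈[< n ] 𝟘 → shift m f ≈[< m ℕ.+ n ] 𝟘
shift-order {n} m f f≈0 k k<m+n with k <? m
... | yes k<m = shift-< f k<m
... | no k≮m  = trans (shift-≥ f m≤k) (f≈0 (k ∸ m) k∸m<n)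
  where
  m≤k = ℕₚ.≮⇒≥ k≮m
  k∸m<n : k ∸ m < n
  k∸m<n = ℕₚ.+-cancelˡ-< m (k ∸ m) n (subst (_< m ℕ.+ n) (sym (ℕₚ.m+[n∸m]≡n m≤k)) k<m+n)

·-shift-order : ∀ {n} c e f → n ≤ e → c · shift e f ≈[< n ] 𝟘
·-shift-order c e f n≤e = ·-order c (shift e f) (≈[<]-weaken n≤e (shift-order₀ e f))

-- The binomials 1 - a q^j and their inverses (only j ≥ 1 is meaningful)

private
  if-≢ : ∀ (a : ℤ) {m n} → m ≢ n → (if ⌊ m ℕ.≟ n ⌋ then a else 0ℤ) ≡ 0ℤ
  if-≢ a {m} {n} m≢n with m ℕ.≟ n
  ... | yes m≡n = ⊥-elim (m≢n m≡n)
  ... | no _    = refl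

  if-≡ : ∀ (a : ℤ) n → (if ⌊ n ℕ.≟ n ⌋ then a else 0ℤ) ≡ a
  if-≡ a n with n ℕ.≟ n
  ... | yes _   = refl
  ... | no n≢n  = ⊥-elim (n≢n refl)

  -- the coefficient geomInv a j k, with r = k % j and q = k / j
  power : ℤ → ℕ → ℕ → ℤ
  power a r q = if ⌊ r ℕ.≟ 0 ⌋ then zpow a q else 0ℤ

oneMinus-≗ : ∀ a j → oneMinus a (suc j) ≗ one ⊖ a · shift (suc j) one
oneMinus-≗ a j zero = sym (cong (λ c → + 1 - c) (ℤₚ.*-zeroʳ a))
oneMinus-≗ a j (suc k) with ℕₚ.<-cmp k j
... | tri< k<j k≢j _ = begin
  (if ⌊ suc k ℕ.≟ suc j ⌋ then - a else 0ℤ)   ≡⟨ if-≢ (- a) (k≢j ∘ ℕₚ.suc-injective) ⟩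
  0ℤ                                          ≡⟨ cong (λ c → 0ℤ - c) (sym (ℤₚ.*-zeroʳ a)) ⟩
  0ℤ - a * 0ℤ                                 ≡⟨ cong (λ c → 0ℤ - a * c) (sym (shift-< one (s≤s k<j))) ⟩
  0ℤ - a * shift (suc j) one (suc k)          ∎
  where open ≡-Reasoning
... | tri≈ _ refl _ = begin
  (if ⌊ suc k ℕ.≟ suc k ⌋ then - a else 0ℤ)   ≡⟨ if-≡ (- a) (suc k) ⟩
  - a                                         ≡⟨ sym (ℤₚ.+-identityˡ (- a)) ⟩
  0ℤ - a                                      ≡⟨ cong (λ c → 0ℤ - c) (sym (ℤₚ.*-identityʳ a)) ⟩
  0ℤ - a * + 1                                ≡⟨ cong (λ c → 0ℤ - a * one c) (sym (ℕₚ.n∸n≡0 k)) ⟩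
  0ℤ - a * one (suc k ∸ suc k)                ≡⟨ cong (λ c → 0ℤ - a * c) (sym (shift-≥ {suc k} one ℕₚ.≤-refl)) ⟩
  0ℤ - a * shift (suc k) one (suc k)          ∎
  where open ≡-Reasoning
... | tri> _ k≢j j<k = begin
  (if ⌊ suc k ℕ.≟ suc j ⌋ then - a else 0ℤ)   ≡⟨ if-≢ (- a) (k≢j ∘ ℕₚ.suc-injective) ⟩
  0ℤ                                          ≡⟨ cong (λ c → 0ℤ - c) (sym (ℤₚ.*-zeroʳ a)) ⟩
  0ℤ - a * 0ℤ                                 ≡⟨ cong (λ c → 0ℤ - a * one c) (sym (ℕₚ.+-∸-assoc 1 j<k)) ⟩
  0ℤ - a * one (suc k ∸ suc j)                ≡⟨ cong (λ c → 0ℤ - a * c) (sym (shift-≥ one (ℕₚ.<⇒≤ (s≤s j<k)))) ⟩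
  0ℤ - a * shift (suc j) one (suc k)          ∎
  where open ≡-Reasoning

⊛-oneMinus : ∀ a j f → f ⊛ oneMinus a (suc j) ≗ f ⊖ a · shift (suc j) f
⊛-oneMinus a j f = begin
  f ⊛ oneMinus a (suc j)                    ≈⟨ ⊛-congˡ f (oneMinus-≗ a j) ⟩
  f ⊛ (one ⊖ a · shift (suc j) one)         ≈⟨ ⊛-distribˡ-⊖ f one (a · shift (suc j) one) ⟩
  f ⊛ one ⊖ f ⊛ (a · shift (suc j) one)     ≈⟨ ⊖-cong (⊛-identityʳ f) (⊛-· a f (shift (suc j) one)) ⟩
  f ⊖ a · (f ⊛ shift (suc j) one)           ≈⟨ ⊖-congˡ f (·-cong a (≗-sym (shift-≗-⊛ (suc j) f))) ⟩
  f ⊖ a · shift (suc j) f                   ∎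
  where open ≗-Reasoning

oneMinus₁-⊛ : ∀ j f → oneMinus (+ 1) (suc j) ⊛ f ≗ f ⊖ shift (suc j) f
oneMinus₁-⊛ j f = begin
  oneMinus (+ 1) (suc j) ⊛ f            ≈⟨ ⊛-comm (oneMinus (+ 1) (suc j)) f ⟩
  f ⊛ oneMinus (+ 1) (suc j)            ≈⟨ ⊛-oneMinus (+ 1) j f ⟩
  f ⊖ (+ 1) · shift (suc j) f           ≈⟨ ⊖-congˡ f (·-identityˡ (shift (suc j) f)) ⟩
  f ⊖ shift (suc j) f                   ∎
  where open ≗-Reasoning

geomInv-unfold : ∀ a j → geomInv a (suc j) ≗ one ⊕ a · shift (suc j) (geomInv a (suc j))
geomInv-unfold a j zero    = sym (cong (λ c → + 1 + c) (ℤₚ.*-zeroʳ a))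
geomInv-unfold a j (suc k) with suc k <? suc j
... | yes k<j = trans (cong (λ r → power a r (suc k / suc j)) (m<n⇒m%n≡m k<j))
                      (sym (trans (cong (λ c → 0ℤ + a * c) (shift-< (geomInv a (suc j)) k<j))
                                  (trans (ℤₚ.+-identityˡ (a * 0ℤ)) (ℤₚ.*-zeroʳ a))))
... | no k≮j = trans (cong₂ (power a) (sym (m≤n⇒[n∸m]%m≡n%m j≤k)) (m/n≡1+[m∸n]/n j≤k))
                     (trans (power-suc (suc k ∸ suc j))
                            (sym (trans (cong (λ c → 0ℤ + a * c) (shift-≥ (geomInv a (suc j)) j≤k))
                                        (ℤₚ.+-identityˡ _))))
  where
  j≤k = ℕₚ.≮⇒≥ k≮j
  power-suc : ∀ n → power a (n % suc j) (suc (n / suc j)) ≡ a * power a (n % suc j) (n / suc j)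
  power-suc n with n % suc j ℕ.≟ 0
  ... | yes _ = refl
  ... | no _  = sym (ℤₚ.*-zeroʳ a)

geomInv-⊛-oneMinus : ∀ a j → geomInv a (suc j) ⊛ oneMinus a (suc j) ≗ one
geomInv-⊛-oneMinus a j k = begin
  (geomInv a (suc j) ⊛ oneMinus a (suc j)) k   ≡⟨ ⊛-oneMinus a j (geomInv a (suc j)) k ⟩
  geomInv a (suc j) k - a·q^j k                ≡⟨ cong (_- a·q^j k) (geomInv-unfold a j k) ⟩
  one k + a·q^j k - a·q^j k                    ≡⟨ cancel (one k) (a·q^j k) ⟩
  one k                                        ∎
  where
  open ≡-Reasoning
  a·q^j = a · shift (suc j) (geomInv a (suc j))
  cancel : ∀ x y → x + y - y ≡ x
  cancel = solve-∀

geomInv-cancel : ∀ a j f → geomInv a (suc j) ⊛ (f ⊖ a · shift (suc j) f) ≗ f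
geomInv-cancel a j f = begin
  g ⊛ (f ⊖ a · shift (suc j) f)   ≈⟨ ⊛-congˡ g (≗-sym (⊛-oneMinus a j f)) ⟩
  g ⊛ (f ⊛ ω)                     ≈⟨ ⊛-congˡ g (⊛-comm f ω) ⟩
  g ⊛ (ω ⊛ f)                     ≈⟨ ≗-sym (⊛-assoc g ω f) ⟩
  (g ⊛ ω) ⊛ f                     ≈⟨ ⊛-congʳ f (geomInv-⊛-oneMinus a j) ⟩
  one ⊛ f                         ≈⟨ ⊛-identityˡ f ⟩
  f                               ∎
  where
  open ≗-Reasoning
  g = geomInv a (suc j)
  ω = oneMinus a (suc j)

oneMinus-≈1 : ∀ a j → oneMinus a (suc j) ≈[< suc j ] one
oneMinus-≈1 a j zero    _         = refl
oneMinus-≈1 a j (suc k) (s≤s k<j) = if-≢ (- a) (λ k≡j → ℕₚ.<-irrefl (ℕₚ.suc-injective k≡j) k<j)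

geomInv-≈1 : ∀ a j → geomInv a (suc j) ≈[< suc j ] one
geomInv-≈1 a j zero    _   = refl
geomInv-≈1 a j (suc k) k<j = cong (λ r → power a r (suc k / suc j)) (m<n⇒m%n≡m k<j)

Summable : (ℕ → FPS) → Set
Summable F = ∀ n → F n ≈[< n ] 𝟘

Σ∞ : (ℕ → FPS) → FPS
Σ∞ F k = sumTo (λ n → F n k) k

Σ∞-truncate : ∀ {F} → Summable F → ∀ {k K} → k ≤ K → Σ∞ F k ≡ sumTo (λ n → F n k) K
Σ∞-truncate {F} summable {k} k≤K = sym (sumTo-extend (λ n → F n k) k≤K (λ n k<n → summable n k k<n))

Σ∞-cong : ∀ {F G} → (∀ n → F n ≗ G n) → Σ∞ F ≗ Σ∞ G
Σ∞-cong F≗G k = sumTo-ext k (λ n → F≗G n k)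

Σ∞-⊕ : ∀ F G → Σ∞ (λ n → F n ⊕ G n) ≗ Σ∞ F ⊕ Σ∞ G
Σ∞-⊕ F G k = sumTo-distrib-+ (λ n → F n k) (λ n → G n k) k

Σ∞-⊖ : ∀ F G → Σ∞ (λ n → F n ⊖ G n) ≗ Σ∞ F ⊖ Σ∞ G
Σ∞-⊖ F G k = sumTo-distrib-- (λ n → F n k) (λ n → G n k) k

Σ∞-· : ∀ c F → Σ∞ (λ n → c · F n) ≗ c · Σ∞ F
Σ∞-· c F k = sumTo-*ˡ c (λ n → F n k) k

Σ∞-swap : ∀ (F : ℕ → ℕ → FPS) → Σ∞ (λ m → Σ∞ (F m)) ≗ Σ∞ (λ n → Σ∞ (λ m → F m n))
Σ∞-swap F k = sumTo-swap (λ m n → F m n k) k k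

Σ∞-unfold : ∀ {F} → Summable F → Σ∞ F ≗ F 0 ⊕ Σ∞ (F ∘ suc)
Σ∞-unfold {F} summable k = trans (Σ∞-truncate summable (ℕₚ.n≤1+n k)) (sumTo-unfoldˡ (λ n → F n k) k)

Σ∞-order : ∀ {b} F → (∀ n → F n ≈[< b ] 𝟘) → Σ∞ F ≈[< b ] 𝟘
Σ∞-order F F≈0 k k<b = sumTo-zero k (λ n _ → F≈0 n k k<b)

Σ∞-⊛ : ∀ {F} → Summable F → ∀ g → Σ∞ F ⊛ g ≗ Σ∞ (λ n → F n ⊛ g)
Σ∞-⊛ {F} summable g k = begin
  sumTo (λ i → Σ∞ F i * g (k ∸ i)) k
    ≡⟨ sumTo-cong k (λ i i≤k → cong (_* g (k ∸ i)) (Σ∞-truncate summable i≤k)) ⟩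
  sumTo (λ i → sumTo (λ n → F n i) k * g (k ∸ i)) k
    ≡⟨ sumTo-ext k (λ i → sym (sumTo-*ʳ (g (k ∸ i)) (λ n → F n i) k)) ⟩
  sumTo (λ i → sumTo (λ n → F n i * g (k ∸ i)) k) k
    ≡⟨ sumTo-swap (λ i n → F n i * g (k ∸ i)) k k ⟩
  Σ∞ (λ n → F n ⊛ g) k ∎
  where open ≡-Reasoning

⊛-Σ∞ : ∀ {F} → Summable F → ∀ g → g ⊛ Σ∞ F ≗ Σ∞ (λ n → g ⊛ F n)
⊛-Σ∞ {F} summable g =
  ≗-trans (⊛-comm g (Σ∞ F)) (≗-trans (Σ∞-⊛ summable g) (Σ∞-cong (λ n → ⊛-comm (F n) g)))

shift-Σ∞ : ∀ {F} → Summable F → ∀ m → shift m (Σ∞ F) ≗ Σ∞ (λ n → shift m (F n))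
shift-Σ∞ {F} summable m = begin
  shift m (Σ∞ F)                         ≈⟨ shift-≗-⊛ m (Σ∞ F) ⟩
  Σ∞ F ⊛ shift m one                     ≈⟨ Σ∞-⊛ summable (shift m one) ⟩
  Σ∞ (λ n → F n ⊛ shift m one)           ≈⟨ Σ∞-cong (λ n → ≗-sym (shift-≗-⊛ m (F n))) ⟩
  Σ∞ (λ n → shift m (F n))               ∎
  where open ≗-Reasoning

shift-summable : ∀ {F} → Summable F → ∀ m → Summable (λ n → shift m (F n))
shift-summable summable m n = ≈[<]-weaken (ℕₚ.m≤n+m n m) (shift-order m _ (summable n))

Σ∞-telescope : ∀ s {F G} → Summable F → Summable G → F 0 ≗ G 0 →
               (∀ x → F (suc x) ⊕ shift s (F x) ≗ G (suc x)) →
               Σ∞ F ⊕ shift s (Σ∞ F) ≗ Σ∞ G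
Σ∞-telescope s {F} {G} F-summable G-summable F₀≗G₀ step = begin
  Σ∞ F ⊕ shift s (Σ∞ F)
    ≈⟨ ⊕-cong (Σ∞-unfold F-summable) (shift-Σ∞ F-summable s) ⟩
  (F 0 ⊕ Σ∞ (F ∘ suc)) ⊕ Σ∞ (λ x → shift s (F x))
    ≈⟨ ⊕-assoc (F 0) (Σ∞ (F ∘ suc)) _ ⟩
  F 0 ⊕ (Σ∞ (F ∘ suc) ⊕ Σ∞ (λ x → shift s (F x)))
    ≈⟨ ⊕-cong F₀≗G₀ (≗-sym (Σ∞-⊕ (F ∘ suc) (λ x → shift s (F x)))) ⟩
  G 0 ⊕ Σ∞ (λ x → F (suc x) ⊕ shift s (F x))
    ≈⟨ ⊕-congˡ (G 0) (Σ∞-cong step) ⟩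
  G 0 ⊕ Σ∞ (G ∘ suc)
    ≈⟨ ≗-sym (Σ∞-unfold G-summable) ⟩
  Σ∞ G ∎
  where open ≗-Reasoning

Σ∞-from : (ℕ → FPS) → ℕ → FPS
Σ∞-from F t = Σ∞ (λ m → F (t ℕ.+ m))

module _ {F : ℕ → FPS} (F≈0 : ∀ n → F n ≈[< suc n ] 𝟘) where

  Σ∞-from-unfold : ∀ t → Σ∞-from F t ≗ F t ⊕ Σ∞-from F (suc t)
  Σ∞-from-unfold t = ≗-trans (Σ∞-unfold summable)
    (⊕-cong (cong-app (cong F (ℕₚ.+-identityʳ t))) (Σ∞-cong (λ m → cong-app (cong F (ℕₚ.+-suc t m)))))
    where
    summable : Summable (λ m → F (t ℕ.+ m))
    summable m = ≈[<]-weaken (ℕₚ.≤-trans (ℕₚ.m≤n+m m t) (ℕₚ.n≤1+n (t ℕ.+ m))) (F≈0 (t ℕ.+ m))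

  Σ∞-from-order : ∀ t → Σ∞-from F t ≈[< suc t ] 𝟘
  Σ∞-from-order t = Σ∞-order (λ m → F (t ℕ.+ m)) (λ m → ≈[<]-weaken (s≤s (ℕₚ.m≤m+n t m)) (F≈0 (t ℕ.+ m)))

Multipliable : (ℕ → FPS) → Set
Multipliable F = ∀ i → F i ≈[< suc i ] one

Π∞ : (ℕ → FPS) → FPS
Π∞ F k = prod F k k

prod-stable : ∀ {F} → Multipliable F → ∀ {k m} → k ≤ m → prod F m k ≡ prod F k k
prod-stable {F} multipliable {k} {m} k≤m =
  trans (cong (λ m → prod F m k) (sym (ℕₚ.m+[n∸m]≡n k≤m))) (stable (m ∸ k))
  where
  stable : ∀ d → prod F (k ℕ.+ d) k ≡ prod F k k
  stable zero    = cong (λ m → prod F m k) (ℕₚ.+-identityʳ k)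
  stable (suc d) = begin
    prod F (k ℕ.+ suc d) k               ≡⟨ cong (λ m → prod F m k) (ℕₚ.+-suc k d) ⟩
    (prod F (k ℕ.+ d) ⊛ F (k ℕ.+ d)) k   ≡⟨ ⊛-identityʳ-below (prod F (k ℕ.+ d)) (F (k ℕ.+ d))
                                              (multipliable (k ℕ.+ d)) k (s≤s (ℕₚ.m≤m+n k d)) ⟩
    prod F (k ℕ.+ d) k                   ≡⟨ stable d ⟩
    prod F k k                           ∎
    where open ≡-Reasoning

prod-unfoldˡ : ∀ F m → prod F (suc m) ≗ F 0 ⊛ prod (F ∘ suc) m
prod-unfoldˡ F zero    = ≗-trans (⊛-identityˡ (F 0)) (≗-sym (⊛-identityʳ (F 0)))
prod-unfoldˡ F (suc m) =
  ≗-trans (⊛-congʳ (F (suc m)) (prod-unfoldˡ F m)) (⊛-assoc (F 0) (prod (F ∘ suc) m) (F (suc m)))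

Π∞-unfold : ∀ {F} → Multipliable F → Π∞ F ≗ F 0 ⊛ Π∞ (F ∘ suc)
Π∞-unfold {F} multipliable k = begin
  prod F k k                                       ≡⟨ sym (prod-stable multipliable (ℕₚ.n≤1+n k)) ⟩
  prod F (suc k) k                                 ≡⟨ prod-unfoldˡ F k k ⟩
  sumTo (λ i → F 0 i * prod (F ∘ suc) k (k ∸ i)) k ≡⟨ sumTo-ext k (λ i → cong (F 0 i *_)
                                                        (prod-stable tail-multipliable (ℕₚ.m∸n≤m k i))) ⟩
  (F 0 ⊛ Π∞ (F ∘ suc)) k                           ∎
  where
  open ≡-Reasoning
  tail-multipliable : Multipliable (F ∘ suc)
  tail-multipliable i = ≈[<]-weaken (ℕₚ.n≤1+n (suc i)) (multipliable (suc i))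

Π∞-cong : ∀ {F G} → (∀ i → F i ≗ G i) → Π∞ F ≗ Π∞ G
Π∞-cong {F} {G} F≗G k = prod-cong k k
  where
  prod-cong : ∀ m → prod F m ≗ prod G m
  prod-cong zero    = ≗-refl
  prod-cong (suc m) = ⊛-cong (prod-cong m) (F≗G m)

Π∞-≈1 : ∀ {b} F → (∀ i → F i ≈[< b ] one) → Π∞ F ≈[< b ] one
Π∞-≈1 {b} F F≈1 k k<b = prod-≈1 k k k<b
  where
  prod-≈1 : ∀ m → prod F m ≈[< b ] one
  prod-≈1 zero    _ _   = refl
  prod-≈1 (suc m) k k<b = trans (⊛-identityʳ-below (prod F m) (F m) (F≈1 m) k k<b) (prod-≈1 m k k<b)

Π∞-from : (ℕ → FPS) → ℕ → FPS
Π∞-from B x = Π∞ (λ i → B (x ℕ.+ i))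

module _ {B : ℕ → FPS} (B≈1 : ∀ j → B j ≈[< suc j ] one) where

  Π∞-from-unfold : ∀ x → Π∞-from B x ≗ B x ⊛ Π∞-from B (suc x)
  Π∞-from-unfold x = ≗-trans (Π∞-unfold multipliable)
    (⊛-cong (cong-app (cong B (ℕₚ.+-identityʳ x))) (Π∞-cong (λ i → cong-app (cong B (ℕₚ.+-suc x i)))))
    where
    multipliable : Multipliable (λ i → B (x ℕ.+ i))
    multipliable i = ≈[<]-weaken (s≤s (ℕₚ.m≤n+m i x)) (B≈1 (x ℕ.+ i))

  Π∞-from-≈1 : ∀ x → Π∞-from B x ≈[< suc x ] one
  Π∞-from-≈1 x = Π∞-≈1 _ (λ i → ≈[<]-weaken (s≤s (ℕₚ.m≤m+n x i)) (B≈1 (x ℕ.+ i)))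

-- Uniqueness of solutions of causal recursions

Causal : (FPS → FPS) → Set
Causal Φ = ∀ {n f g} → f ≈[< n ] g → Φ f ≈[< n ] Φ g

⊛-causal : ∀ f → Causal (f ⊛_)
⊛-causal f = ⊛-congˡ-below f

recursion-unique : ∀ (Φ : ℕ → FPS → FPS) → (∀ t → Causal (Φ t)) → ∀ {A B : ℕ → FPS} →
                   (∀ t → A t ≗ Φ t (A (suc t))) → (∀ t → B t ≗ Φ t (B (suc t))) →
                   (∀ t → A t ≈[< suc t ] B t) → ∀ t → A t ≗ B t
recursion-unique Φ causal {A} {B} A-rec B-rec A≈B t k = agree k t k (s≤s (ℕₚ.m≤m+n k t))
  where
  agree : ∀ d t → A t ≈[< suc (d ℕ.+ t) ] B t
  agree zero    t = A≈B t
  agree (suc d) t k k<n =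
    trans (A-rec t k) (trans (causal t next k k<n) (sym (B-rec t k)))
    where
    next : A (suc t) ≈[< suc (suc d ℕ.+ t) ] B (suc t)
    next = subst (λ n → A (suc t) ≈[< suc n ] B (suc t)) (ℕₚ.+-suc d t) (agree d (suc t))

-- Euler's expansion of (q^(x+1);q)_∞

qPochFrom : ℕ → FPS
qPochFrom = Π∞-from (oneMinus (+ 1) ∘ suc)

qPochFrom-unfold : ∀ x → qPochFrom x ≗ oneMinus (+ 1) (suc x) ⊛ qPochFrom (suc x)
qPochFrom-unfold = Π∞-from-unfold (oneMinus-≈1 (+ 1))

qPochFrom-≈1 : ∀ x → qPochFrom x ≈[< suc x ] one
qPochFrom-≈1 = Π∞-from-≈1 (oneMinus-≈1 (+ 1))

shift-qPochFrom : ∀ e x →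
                  shift e (qPochFrom x) ≗ shift e (qPochFrom (suc x)) ⊖ shift (e ℕ.+ suc x) (qPochFrom (suc x))
shift-qPochFrom e x = shift-⊖-shift e (suc x) {qPochFrom x} {qPochFrom (suc x)}
  (≗-trans (qPochFrom-unfold x) (oneMinus₁-⊛ x (qPochFrom (suc x))))

shift-qPochInv : ∀ e m →
                 shift e (qPochInv m) ≗ shift e (qPochInv (suc m)) ⊖ shift (e ℕ.+ suc m) (qPochInv (suc m))
shift-qPochInv e m = shift-⊖-shift e (suc m) {qPochInv m} {qPochInv (suc m)} (begin
  qPochInv m
    ≈⟨ ≗-sym (⊛-identityʳ (qPochInv m)) ⟩
  qPochInv m ⊛ one
    ≈⟨ ⊛-congˡ (qPochInv m) (≗-sym (geomInv-⊛-oneMinus (+ 1) m)) ⟩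
  qPochInv m ⊛ (geomInv (+ 1) (suc m) ⊛ oneMinus (+ 1) (suc m))
    ≈⟨ ≗-sym (⊛-assoc (qPochInv m) (geomInv (+ 1) (suc m)) (oneMinus (+ 1) (suc m))) ⟩
  qPochInv (suc m) ⊛ oneMinus (+ 1) (suc m)
    ≈⟨ ⊛-comm (qPochInv (suc m)) (oneMinus (+ 1) (suc m)) ⟩
  oneMinus (+ 1) (suc m) ⊛ qPochInv (suc m)
    ≈⟨ oneMinus₁-⊛ m (qPochInv (suc m)) ⟩
  qPochInv (suc m) ⊖ shift (suc m) (qPochInv (suc m)) ∎)
  where open ≗-Reasoning

triangular : ℕ → ℕ
triangular zero    = 0
triangular (suc m) = triangular m ℕ.+ suc m

m≤triangular : ∀ m → m ≤ triangular m
m≤triangular zero    = z≤n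
m≤triangular (suc m) = ℕₚ.m≤n+m (suc m) (triangular m)

eulerTerm : ℕ → ℕ → FPS
eulerTerm x m = sign m · shift (triangular m ℕ.+ m ℕ.* x) (qPochInv m)

eulerSeries : ℕ → FPS
eulerSeries x = Σ∞ (eulerTerm x)

eulerTerm-summable : ∀ x → Summable (eulerTerm x)
eulerTerm-summable x m = ·-shift-order (sign m) (triangular m ℕ.+ m ℕ.* x) (qPochInv m)
  (ℕₚ.≤-trans (m≤triangular m) (ℕₚ.m≤m+n (triangular m) (m ℕ.* x)))

eulerTerm-step : ∀ x m → eulerTerm x (suc m) ≗ eulerTerm (suc x) (suc m) ⊖ shift (suc x) (eulerTerm (suc x) m)
eulerTerm-step x m k = begin
  (- sign m) * shift (T ℕ.+ suc m ℕ.+ suc m ℕ.* x) P′ k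
    ≡⟨ cong ((- sign m) *_) (shift-congˡ P′ (sym (exponent₁ x m T)) k) ⟩
  (- sign m) * A
    ≡⟨ rearrange (sign m) A B ⟩
  (- sign m) * B - sign m * (A - B)
    ≡⟨ cong₂ (λ u v → (- sign m) * u - sign m * v) (shift-congˡ P′ (exponent₂ x m T) k) (sym shifted) ⟩
  (- sign m) * shift (T ℕ.+ suc m ℕ.+ suc m ℕ.* suc x) P′ k - sign m * shift (suc x) Pₘ k
    ≡⟨ cong (λ c → (- sign m) * shift (T ℕ.+ suc m ℕ.+ suc m ℕ.* suc x) P′ k - c)
            (sym (shift-· (suc x) (sign m) Pₘ k)) ⟩
  (eulerTerm (suc x) (suc m) ⊖ shift (suc x) (eulerTerm (suc x) m)) k ∎
  where
  open ≡-Reasoning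
  T  = triangular m
  Pₘ = shift (T ℕ.+ m ℕ.* suc x) (qPochInv m)
  P′ = qPochInv (suc m)
  e  = suc x ℕ.+ (T ℕ.+ m ℕ.* suc x)
  A  = shift e P′ k
  B  = shift (e ℕ.+ suc m) P′ k
  shifted : shift (suc x) Pₘ k ≡ A - B
  shifted = trans (shift-shift (suc x) (T ℕ.+ m ℕ.* suc x) (qPochInv m) k) (shift-qPochInv e m k)
  exponent₁ : ∀ x m T → suc x ℕ.+ (T ℕ.+ m ℕ.* suc x) ≡ T ℕ.+ suc m ℕ.+ suc m ℕ.* x
  exponent₁ = ℕSolver.solve-∀
  exponent₂ : ∀ x m T → suc x ℕ.+ (T ℕ.+ m ℕ.* suc x) ℕ.+ suc m ≡ T ℕ.+ suc m ℕ.+ suc m ℕ.* suc x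
  exponent₂ = ℕSolver.solve-∀
  rearrange : ∀ s a b → (- s) * a ≡ (- s) * b - s * (a - b)
  rearrange = solve-∀

eulerSeries-unfold : ∀ x → eulerSeries x ≗ oneMinus (+ 1) (suc x) ⊛ eulerSeries (suc x)
eulerSeries-unfold x = begin
  eulerSeries x
    ≈⟨ Σ∞-unfold (eulerTerm-summable x) ⟩
  E 0 ⊕ Σ∞ (E ∘ suc)
    ≈⟨ ⊕-congˡ (E 0) (≗-trans (Σ∞-cong (eulerTerm-step x))
                              (Σ∞-⊖ (E′ ∘ suc) (λ m → shift (suc x) (E′ m)))) ⟩
  E′ 0 ⊕ (Σ∞ (E′ ∘ suc) ⊖ Σ∞ (λ m → shift (suc x) (E′ m)))
    ≈⟨ (λ k → sym (ℤₚ.+-assoc (E′ 0 k) _ _)) ⟩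
  (E′ 0 ⊕ Σ∞ (E′ ∘ suc)) ⊖ Σ∞ (λ m → shift (suc x) (E′ m))
    ≈⟨ ⊖-cong (≗-sym (Σ∞-unfold (eulerTerm-summable (suc x))))
              (≗-sym (shift-Σ∞ (eulerTerm-summable (suc x)) (suc x))) ⟩
  eulerSeries (suc x) ⊖ shift (suc x) (eulerSeries (suc x))
    ≈⟨ ≗-sym (oneMinus₁-⊛ x (eulerSeries (suc x))) ⟩
  oneMinus (+ 1) (suc x) ⊛ eulerSeries (suc x) ∎
  where
  open ≗-Reasoning
  E  = eulerTerm x
  E′ = eulerTerm (suc x)

eulerSeries-≈1 : ∀ x → eulerSeries x ≈[< suc x ] one
eulerSeries-≈1 x k k<x = begin
  eulerSeries x k                               ≡⟨ Σ∞-unfold (eulerTerm-summable x) k ⟩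
  eulerTerm x 0 k + Σ∞ (eulerTerm x ∘ suc) k    ≡⟨ cong₂ _+_ (ℤₚ.*-identityˡ (one k))
                                                             (Σ∞-order (eulerTerm x ∘ suc) higher k k<x) ⟩
  one k + 0ℤ                                    ≡⟨ ℤₚ.+-identityʳ (one k) ⟩
  one k                                         ∎
  where
  open ≡-Reasoning
  higher : ∀ m → eulerTerm x (suc m) ≈[< suc x ] 𝟘
  higher m = ·-shift-order (sign (suc m)) (triangular (suc m) ℕ.+ suc m ℕ.* x) (qPochInv (suc m))
    (ℕₚ.+-mono-≤ (ℕₚ.≤-trans (s≤s z≤n) (m≤triangular (suc m))) (ℕₚ.m≤n*m x (suc m)))

qPochFrom-euler : ∀ x → qPochFrom x ≗ eulerSeries x
qPochFrom-euler =
  recursion-unique (λ x → oneMinus (+ 1) (suc x) ⊛_) (λ x → ⊛-causal (oneMinus (+ 1) (suc x)))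
  qPochFrom-unfold eulerSeries-unfold (λ x → ≈[<]-trans (qPochFrom-≈1 x) (≈[<]-sym (eulerSeries-≈1 x)))

-- Σ_x (-1)^x z^x (q^(x+1);q)_∞  and  Σ_x (-1)^x (x+1) z^(x+1) (q^(x+2);q)_∞  at z = q^(t+1)

signedPochTerm : ℕ → ℕ → FPS
signedPochTerm t x = sign x · shift (x ℕ.* suc t) (qPochFrom x)

signedPochSum : ℕ → FPS
signedPochSum t = Σ∞ (signedPochTerm t)

weightedPochTerm : ℕ → ℕ → FPS
weightedPochTerm t x = (sign x * + suc x) · shift (suc x ℕ.* suc t) (qPochFrom (suc x))

weightedPochSum : ℕ → FPS
weightedPochSum t = Σ∞ (weightedPochTerm t)

signedPochTerm-summable : ∀ t → Summable (signedPochTerm t)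
signedPochTerm-summable t x = ·-shift-order (sign x) (x ℕ.* suc t) (qPochFrom x) (ℕₚ.m≤m*n x (suc t))

weightedPochTerm-summable : ∀ t → Summable (weightedPochTerm t)
weightedPochTerm-summable t x = ·-shift-order (sign x * + suc x) (suc x ℕ.* suc t) (qPochFrom (suc x))
  (ℕₚ.≤-trans (ℕₚ.n≤1+n x) (ℕₚ.m≤m*n (suc x) (suc t)))

shift-pochTerm : ∀ t x c k →
                 shift (suc t) (c · shift (x ℕ.* suc t) (qPochFrom x)) k ≡
                 c * (shift (suc x ℕ.* suc t) (qPochFrom (suc x)) k
                      - shift (suc x ℕ.* suc (suc t)) (qPochFrom (suc x)) k)
shift-pochTerm t x c k = begin
  shift (suc t) (c · shift (x ℕ.* suc t) (qPochFrom x)) k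
    ≡⟨ shift-·-shift (suc t) c (x ℕ.* suc t) (qPochFrom x) k ⟩
  c * shift (suc x ℕ.* suc t) (qPochFrom x) k
    ≡⟨ cong (c *_) (shift-qPochFrom (suc x ℕ.* suc t) x k) ⟩
  c * (A - shift (suc x ℕ.* suc t ℕ.+ suc x) (qPochFrom (suc x)) k)
    ≡⟨ cong (λ e → c * (A - shift e (qPochFrom (suc x)) k)) (exponent x t) ⟩
  c * (A - shift (suc x ℕ.* suc (suc t)) (qPochFrom (suc x)) k) ∎
  where
  open ≡-Reasoning
  A = shift (suc x ℕ.* suc t) (qPochFrom (suc x)) k
  exponent : ∀ x t → suc x ℕ.* suc t ℕ.+ suc x ≡ suc x ℕ.* suc (suc t)
  exponent = ℕSolver.solve-∀

signedPochTerm-step : ∀ t x → signedPochTerm t (suc x) ⊕ shift (suc t) (signedPochTerm t x) ≗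
                              signedPochTerm (suc t) (suc x)
signedPochTerm-step t x k =
  trans (cong (λ c → (- sign x) * A + c) (shift-pochTerm t x (sign x) k)) (rearrange (sign x) A B)
  where
  A = shift (suc x ℕ.* suc t) (qPochFrom (suc x)) k
  B = shift (suc x ℕ.* suc (suc t)) (qPochFrom (suc x)) k
  rearrange : ∀ s a b → (- s) * a + s * (a - b) ≡ (- s) * b
  rearrange = solve-∀

signedPochSum-step : ∀ t → signedPochSum t ⊕ shift (suc t) (signedPochSum t) ≗ signedPochSum (suc t)
signedPochSum-step t = Σ∞-telescope (suc t) (signedPochTerm-summable t) (signedPochTerm-summable (suc t))
  ≗-refl (signedPochTerm-step t)

signedPochSum-≈ : ∀ t → signedPochSum t ≈[< suc t ] qPochFrom 0
signedPochSum-≈ t k k<t = begin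
  signedPochSum t k                                      ≡⟨ Σ∞-unfold (signedPochTerm-summable t) k ⟩
  signedPochTerm t 0 k + Σ∞ (signedPochTerm t ∘ suc) k   ≡⟨ cong₂ _+_ (ℤₚ.*-identityˡ (qPochFrom 0 k))
                                                                      (Σ∞-order (signedPochTerm t ∘ suc) higher k k<t) ⟩
  qPochFrom 0 k + 0ℤ                                     ≡⟨ ℤₚ.+-identityʳ (qPochFrom 0 k) ⟩
  qPochFrom 0 k                                          ∎
  where
  open ≡-Reasoning
  higher : ∀ x → signedPochTerm t (suc x) ≈[< suc t ] 𝟘
  higher x = ·-shift-order (sign (suc x)) (suc x ℕ.* suc t) (qPochFrom (suc x)) (ℕₚ.m≤n*m (suc t) (suc x))

weightedPochSum-order : ∀ t → weightedPochSum t ≈[< suc t ] 𝟘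
weightedPochSum-order t = Σ∞-order (weightedPochTerm t) (λ x →
  ·-shift-order (sign x * + suc x) (suc x ℕ.* suc t) (qPochFrom (suc x)) (ℕₚ.m≤n*m (suc t) (suc x)))

weightedPochTerm-step : ∀ t x → weightedPochTerm t (suc x) ⊕ shift (suc t) (weightedPochTerm t x) ≗
                                weightedPochTerm (suc t) (suc x) ⊕ shift (suc t) (signedPochTerm t (suc x))
weightedPochTerm-step t x k = begin
  c₁ * A + shift (suc t) (weightedPochTerm t x) k
    ≡⟨ cong (λ c → c₁ * A + c) (shift-pochTerm t (suc x) c₀ k) ⟩
  c₁ * A + c₀ * (A - B)
    ≡⟨ rearrange (sign x) (+ suc x) A B ⟩
  c₁ * B + (- sign x) * (A - B)
    ≡⟨ cong (λ c → c₁ * B + c) (sym (shift-pochTerm t (suc x) (- sign x) k)) ⟩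
  (weightedPochTerm (suc t) (suc x) ⊕ shift (suc t) (signedPochTerm t (suc x))) k ∎
  where
  open ≡-Reasoning
  c₀ = sign x * + suc x
  c₁ = sign (suc x) * + suc (suc x)
  A  = shift (suc (suc x) ℕ.* suc t) (qPochFrom (suc (suc x))) k
  B  = shift (suc (suc x) ℕ.* suc (suc t)) (qPochFrom (suc (suc x))) k
  rearrange : ∀ s X a b → ((- s) * (+ 1 + X)) * a + (s * X) * (a - b) ≡
                          ((- s) * (+ 1 + X)) * b + (- s) * (a - b)
  rearrange = solve-∀

weightedPochTerm-head : ∀ t → weightedPochTerm t 0 ≗
                              weightedPochTerm (suc t) 0 ⊕ shift (suc t) (signedPochTerm t 0)
weightedPochTerm-head t k =
  trans (rearrange A B) (cong (λ c → + 1 * B + c) (sym (shift-pochTerm t 0 (+ 1) k)))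
  where
  A = shift (1 ℕ.* suc t) (qPochFrom 1) k
  B = shift (1 ℕ.* suc (suc t)) (qPochFrom 1) k
  rearrange : ∀ a b → + 1 * a ≡ + 1 * b + + 1 * (a - b)
  rearrange = solve-∀

weightedPochSum-step : ∀ t → weightedPochSum t ⊕ shift (suc t) (weightedPochSum t) ≗
                             weightedPochSum (suc t) ⊕ shift (suc t) (signedPochSum t)
weightedPochSum-step t = begin
  weightedPochSum t ⊕ shift (suc t) (weightedPochSum t)
    ≈⟨ Σ∞-telescope (suc t) (weightedPochTerm-summable t) summable
         (weightedPochTerm-head t) (weightedPochTerm-step t) ⟩
  Σ∞ (λ x → weightedPochTerm (suc t) x ⊕ shift (suc t) (signedPochTerm t x))
    ≈⟨ Σ∞-⊕ (weightedPochTerm (suc t)) (λ x → shift (suc t) (signedPochTerm t x)) ⟩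
  weightedPochSum (suc t) ⊕ Σ∞ (λ x → shift (suc t) (signedPochTerm t x))
    ≈⟨ ⊕-congˡ (weightedPochSum (suc t)) (≗-sym (shift-Σ∞ (signedPochTerm-summable t) (suc t))) ⟩
  weightedPochSum (suc t) ⊕ shift (suc t) (signedPochSum t) ∎
  where
  open ≗-Reasoning
  summable : Summable (λ x → weightedPochTerm (suc t) x ⊕ shift (suc t) (signedPochTerm t x))
  summable x k k<x = cong₂ _+_ (weightedPochTerm-summable (suc t) x k k<x)
                               (shift-summable (signedPochTerm-summable t) (suc t) x k k<x)

-- The closed forms: (q;q)_∞ / (-q^(t+1);q)_∞ and its product with Σ_(n>t) q^n/(1+q^n)

invOnePlus : ℕ → FPS
invOnePlus t = geomInv (- + 1) (suc t)

invOnePlus-cancel : ∀ t f → invOnePlus t ⊛ (f ⊕ shift (suc t) f) ≗ f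
invOnePlus-cancel t f = ≗-trans (⊛-congˡ (invOnePlus t) as-difference) (geomInv-cancel (- + 1) t f)
  where
  subtract-negated : ∀ a b → a + b ≡ a - (- + 1) * b
  subtract-negated = solve-∀
  as-difference : f ⊕ shift (suc t) f ≗ f ⊖ (- + 1) · shift (suc t) f
  as-difference k = subtract-negated (f k) (shift (suc t) f k)

negqPochInvFrom : ℕ → FPS
negqPochInvFrom = Π∞-from invOnePlus

lambertTerm : ℕ → FPS
lambertTerm n = shift (suc n) (invOnePlus n)

lambertTerm-order : ∀ n → lambertTerm n ≈[< suc n ] 𝟘
lambertTerm-order n = shift-order₀ (suc n) (invOnePlus n)

lambertFrom : ℕ → FPS
lambertFrom = Σ∞-from lambertTerm

pochRatio : ℕ → FPS
pochRatio t = qPochFrom 0 ⊛ negqPochInvFrom t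

pochRatio-unfold : ∀ t → pochRatio t ≗ invOnePlus t ⊛ pochRatio (suc t)
pochRatio-unfold t = ≗-trans (⊛-congˡ (qPochFrom 0) (Π∞-from-unfold (geomInv-≈1 (- + 1)) t))
                             (⊛-exchange (qPochFrom 0) (invOnePlus t) (negqPochInvFrom (suc t)))

pochRatio-≈ : ∀ t → pochRatio t ≈[< suc t ] qPochFrom 0
pochRatio-≈ t = ⊛-identityʳ-below (qPochFrom 0) (negqPochInvFrom t) (Π∞-from-≈1 (geomInv-≈1 (- + 1)) t)

signedPochSum-closed : ∀ t → signedPochSum t ≗ pochRatio t
signedPochSum-closed = recursion-unique (λ t → invOnePlus t ⊛_) (λ t → ⊛-causal (invOnePlus t))
  signedPochSum-unfold pochRatio-unfold (λ t → ≈[<]-trans (signedPochSum-≈ t) (≈[<]-sym (pochRatio-≈ t)))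
  where
  signedPochSum-unfold : ∀ t → signedPochSum t ≗ invOnePlus t ⊛ signedPochSum (suc t)
  signedPochSum-unfold t = ≗-trans (≗-sym (invOnePlus-cancel t (signedPochSum t)))
                                   (⊛-congˡ (invOnePlus t) (signedPochSum-step t))

pochRatioLambert : ℕ → FPS
pochRatioLambert t = pochRatio t ⊛ lambertFrom t

pochRatioLambert-unfold : ∀ t → pochRatioLambert t ≗
                                invOnePlus t ⊛ (pochRatioLambert (suc t) ⊕ shift (suc t) (pochRatio t))
pochRatioLambert-unfold t = begin
  pochRatio t ⊛ lambertFrom t
    ≈⟨ ⊛-congˡ (pochRatio t) (Σ∞-from-unfold lambertTerm-order t) ⟩
  pochRatio t ⊛ (shift (suc t) g ⊕ lambertFrom (suc t))
    ≈⟨ ⊛-distribˡ-⊕ (pochRatio t) (shift (suc t) g) (lambertFrom (suc t)) ⟩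
  pochRatio t ⊛ shift (suc t) g ⊕ pochRatio t ⊛ lambertFrom (suc t)
    ≈⟨ ⊕-cong (≗-trans (⊛-shift (suc t) (pochRatio t) g)
                (≗-trans (shift-congʳ (suc t) (⊛-comm (pochRatio t) g))
                         (≗-sym (⊛-shift (suc t) g (pochRatio t)))))
              (≗-trans (⊛-congʳ (lambertFrom (suc t)) (pochRatio-unfold t))
                       (⊛-assoc g (pochRatio (suc t)) (lambertFrom (suc t)))) ⟩
  g ⊛ shift (suc t) (pochRatio t) ⊕ g ⊛ pochRatioLambert (suc t)
    ≈⟨ ≗-sym (⊛-distribˡ-⊕ g (shift (suc t) (pochRatio t)) (pochRatioLambert (suc t))) ⟩
  g ⊛ (shift (suc t) (pochRatio t) ⊕ pochRatioLambert (suc t))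
    ≈⟨ ⊛-congˡ g (⊕-comm (shift (suc t) (pochRatio t)) (pochRatioLambert (suc t))) ⟩
  g ⊛ (pochRatioLambert (suc t) ⊕ shift (suc t) (pochRatio t)) ∎
  where
  open ≗-Reasoning
  g = invOnePlus t

weightedPochSum-closed : ∀ t → weightedPochSum t ≗ pochRatioLambert t
weightedPochSum-closed = recursion-unique Φ causal weightedPochSum-unfold pochRatioLambert-unfold
  (λ t → ≈[<]-trans (weightedPochSum-order t)
                     (≈[<]-sym (⊛-orderʳ (pochRatio t) (lambertFrom t) (Σ∞-from-order lambertTerm-order t))))
  where
  Φ : ℕ → FPS → FPS
  Φ t f = invOnePlus t ⊛ (f ⊕ shift (suc t) (pochRatio t))
  causal : ∀ t → Causal (Φ t)
  causal t f≈g = ⊛-causal (invOnePlus t) (λ k k<n → cong (_+ shift (suc t) (pochRatio t) k) (f≈g k k<n))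
  weightedPochSum-unfold : ∀ t → weightedPochSum t ≗ Φ t (weightedPochSum (suc t))
  weightedPochSum-unfold t = begin
    weightedPochSum t
      ≈⟨ ≗-sym (invOnePlus-cancel t (weightedPochSum t)) ⟩
    invOnePlus t ⊛ (weightedPochSum t ⊕ shift (suc t) (weightedPochSum t))
      ≈⟨ ⊛-congˡ (invOnePlus t) (weightedPochSum-step t) ⟩
    invOnePlus t ⊛ (weightedPochSum (suc t) ⊕ shift (suc t) (signedPochSum t))
      ≈⟨ ⊛-congˡ (invOnePlus t) (⊕-congˡ (weightedPochSum (suc t))
                                          (shift-congʳ (suc t) (signedPochSum-closed t))) ⟩
    Φ t (weightedPochSum (suc t)) ∎
    where open ≗-Reasoning

rhs≗weightedPochSum : rhsSeries ≗ weightedPochSum 0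
rhs≗weightedPochSum = ≗-sym (weightedPochSum-closed 0)

-- The middle series

altPowers : ℕ → ℕ → FPS
altPowers n x = sign x · shift (suc x ℕ.* n) one

altWeightedPowers : ℕ → ℕ → FPS
altWeightedPowers n x = (sign x * + suc x) · shift (suc x ℕ.* n) one

altPowers-summable : ∀ m → Summable (altPowers (suc m))
altPowers-summable m x = ·-shift-order (sign x) (suc x ℕ.* suc m) one
  (ℕₚ.≤-trans (ℕₚ.n≤1+n x) (ℕₚ.m≤m*n (suc x) (suc m)))

altWeightedPowers-summable : ∀ m → Summable (altWeightedPowers (suc m))
altWeightedPowers-summable m x = ·-shift-order (sign x * + suc x) (suc x ℕ.* suc m) one
  (ℕₚ.≤-trans (ℕₚ.n≤1+n x) (ℕₚ.m≤m*n (suc x) (suc m)))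

Σ∞-altPowers : ∀ m → Σ∞ (altPowers (suc m)) ≗ invOnePlus m ⊛ shift (suc m) one
Σ∞-altPowers m = ≗-trans (≗-sym (invOnePlus-cancel m (Σ∞ (altPowers (suc m)))))
  (⊛-congˡ (invOnePlus m) (≗-trans telescope Σ∞-head))
  where
  head : ℕ → FPS
  head zero    = shift (suc m) one
  head (suc _) = 𝟘
  head-summable : Summable head
  head-summable zero    _ ()
  head-summable (suc _) _ _ = refl
  Σ∞-head : Σ∞ head ≗ shift (suc m) one
  Σ∞-head k = trans (Σ∞-unfold head-summable k)
                    (trans (cong (λ c → shift (suc m) one k + c) (sumTo-zero k (λ _ _ → refl)))
                           (ℤₚ.+-identityʳ _))
  cancel : ∀ s z → (- s) * z + s * z ≡ 0ℤ
  cancel = solve-∀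
  step : ∀ x → altPowers (suc m) (suc x) ⊕ shift (suc m) (altPowers (suc m) x) ≗ 𝟘
  step x k = trans (cong (λ c → (- sign x) * shift (suc (suc x) ℕ.* suc m) one k + c)
                         (shift-·-shift (suc m) (sign x) (suc x ℕ.* suc m) one k))
                   (cancel (sign x) (shift (suc (suc x) ℕ.* suc m) one k))
  telescope = Σ∞-telescope (suc m) (altPowers-summable m) head-summable
                           (λ k → trans (ℤₚ.*-identityˡ _) (shift-congˡ one (ℕₚ.+-identityʳ (suc m)) k)) step

Σ∞-altWeightedPowers : ∀ m → Σ∞ (altWeightedPowers (suc m)) ≗ shift (suc m) (invOnePlus m ⊛ invOnePlus m)
Σ∞-altWeightedPowers m = begin
  H                                       ≈⟨ ≗-sym (invOnePlus-cancel m H) ⟩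
  g ⊛ (H ⊕ shift (suc m) H)               ≈⟨ ⊛-congˡ g telescope ⟩
  g ⊛ Σ∞ (altPowers (suc m))              ≈⟨ ⊛-congˡ g (Σ∞-altPowers m) ⟩
  g ⊛ (g ⊛ shift (suc m) one)             ≈⟨ ⊛-congˡ g (≗-sym (shift-≗-⊛ (suc m) g)) ⟩
  g ⊛ shift (suc m) g                     ≈⟨ ⊛-shift (suc m) g g ⟩
  shift (suc m) (g ⊛ g)                   ∎
  where
  open ≗-Reasoning
  g = invOnePlus m
  H = Σ∞ (altWeightedPowers (suc m))
  merge : ∀ s X z → ((- s) * (+ 1 + X)) * z + (s * X) * z ≡ (- s) * z
  merge = solve-∀
  step : ∀ x → altWeightedPowers (suc m) (suc x) ⊕ shift (suc m) (altWeightedPowers (suc m) x) ≗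
               altPowers (suc m) (suc x)
  step x k = trans (cong (λ c → (sign (suc x) * + suc (suc x)) * shift (suc (suc x) ℕ.* suc m) one k + c)
                         (shift-·-shift (suc m) (sign x * + suc x) (suc x ℕ.* suc m) one k))
                   (merge (sign x) (+ suc x) (shift (suc (suc x) ℕ.* suc m) one k))
  telescope = Σ∞-telescope (suc m) (altWeightedPowers-summable m) (altPowers-summable m) ≗-refl step

triangular-closed : ∀ m → (suc m ℕ.* suc (suc m)) / 2 ≡ triangular (suc m)
triangular-closed m = trans (cong (_/ 2) (sym (twice (suc m)))) (m*n/n≡m (triangular (suc m)) 2)
  where
  twice : ∀ n → triangular n ℕ.* 2 ≡ n ℕ.* suc n
  twice zero    = refl
  twice (suc n) = trans (ℕₚ.*-distribʳ-+ 2 (triangular n) (suc n))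
                        (trans (cong (ℕ._+ suc n ℕ.* 2) (twice n)) (expand n))
    where
    expand : ∀ n → n ℕ.* suc n ℕ.+ suc n ℕ.* 2 ≡ suc n ℕ.* suc (suc n)
    expand = ℕSolver.solve-∀

-- Row x sums to weightedPochTerm 0 x, column m to midTerm m.
middleEntry : ℕ → ℕ → FPS
middleEntry x m = (sign x * + suc x) · shift (suc x ℕ.* 1) (eulerTerm (suc x) m)

weightedPochSum-rows : weightedPochSum 0 ≗ Σ∞ (λ x → Σ∞ (middleEntry x))
weightedPochSum-rows = Σ∞-cong row
  where
  row : ∀ x → weightedPochTerm 0 x ≗ Σ∞ (middleEntry x)
  row x = ≗-trans (·-cong c (≗-trans (shift-congʳ e (qPochFrom-euler (suc x)))
                                     (shift-Σ∞ (eulerTerm-summable (suc x)) e)))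
                  (≗-sym (Σ∞-· c (λ m → shift e (eulerTerm (suc x) m))))
    where
    c = sign x * + suc x
    e = suc x ℕ.* 1

middleEntry-≗ : ∀ x m → middleEntry x m ≗
                        sign m · shift (triangular m) (qPochInv m ⊛ altWeightedPowers (suc m) x)
middleEntry-≗ x m k = begin
  c * shift e (sign m · shift E (qPochInv m)) k
    ≡⟨ cong (c *_) (trans (shift-·-shift e (sign m) E (qPochInv m) k)
                          (cong (sign m *_) (shift-congˡ (qPochInv m) (exponent x m T) k))) ⟩
  c * (sign m * shift (T ℕ.+ suc x ℕ.* suc m) (qPochInv m) k)
    ≡⟨ exchange c (sign m) _ ⟩
  sign m * (c * shift (T ℕ.+ suc x ℕ.* suc m) (qPochInv m) k)
    ≡⟨ cong (sign m *_) (sym convolved) ⟩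
  sign m * shift T (qPochInv m ⊛ altWeightedPowers (suc m) x) k ∎
  where
  open ≡-Reasoning
  c = sign x * + suc x
  e = suc x ℕ.* 1
  T = triangular m
  E = T ℕ.+ m ℕ.* suc x
  exponent : ∀ x m T → suc x ℕ.* 1 ℕ.+ (T ℕ.+ m ℕ.* suc x) ≡ T ℕ.+ suc x ℕ.* suc m
  exponent = ℕSolver.solve-∀
  exchange : ∀ a b d → a * (b * d) ≡ b * (a * d)
  exchange = solve-∀
  convolved : shift T (qPochInv m ⊛ altWeightedPowers (suc m) x) k ≡
              c * shift (T ℕ.+ suc x ℕ.* suc m) (qPochInv m) k
  convolved = begin
    shift T (qPochInv m ⊛ (c · shift (suc x ℕ.* suc m) one)) k
      ≡⟨ shift-congʳ T (≗-trans (⊛-· c (qPochInv m) (shift (suc x ℕ.* suc m) one))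
                                (·-cong c (≗-sym (shift-≗-⊛ (suc x ℕ.* suc m) (qPochInv m))))) k ⟩
    shift T (c · shift (suc x ℕ.* suc m) (qPochInv m)) k
      ≡⟨ shift-·-shift T c (suc x ℕ.* suc m) (qPochInv m) k ⟩
    c * shift (T ℕ.+ suc x ℕ.* suc m) (qPochInv m) k ∎

Σ∞-middleColumn : ∀ m → Σ∞ (λ x → middleEntry x m) ≗ midTerm m
Σ∞-middleColumn m = begin
  Σ∞ (λ x → middleEntry x m)
    ≈⟨ Σ∞-cong (λ x → middleEntry-≗ x m) ⟩
  Σ∞ (λ x → sign m · shift T (P ⊛ altWeightedPowers (suc m) x))
    ≈⟨ Σ∞-· (sign m) (λ x → shift T (P ⊛ altWeightedPowers (suc m) x)) ⟩
  sign m · Σ∞ (λ x → shift T (P ⊛ altWeightedPowers (suc m) x))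
    ≈⟨ ·-cong (sign m) (≗-sym (shift-Σ∞ convolved-summable T)) ⟩
  sign m · shift T (Σ∞ (λ x → P ⊛ altWeightedPowers (suc m) x))
    ≈⟨ ·-cong (sign m) (shift-congʳ T (≗-sym (⊛-Σ∞ (altWeightedPowers-summable m) P))) ⟩
  sign m · shift T (P ⊛ Σ∞ (altWeightedPowers (suc m)))
    ≈⟨ ·-cong (sign m) (shift-congʳ T (⊛-congˡ P (Σ∞-altWeightedPowers m))) ⟩
  sign m · shift T (P ⊛ shift (suc m) (g ⊛ g))
    ≈⟨ ·-cong (sign m) (shift-congʳ T (≗-trans (⊛-shift (suc m) P (g ⊛ g))
                                               (shift-congʳ (suc m) (≗-sym (⊛-assoc P g g))))) ⟩
  sign m · shift T (shift (suc m) (P ⊛ g ⊛ g))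
    ≈⟨ ·-cong (sign m) (≗-trans (shift-shift T (suc m) (P ⊛ g ⊛ g))
                                (shift-congˡ (P ⊛ g ⊛ g) (sym (triangular-closed m)))) ⟩
  midTerm m ∎
  where
  open ≗-Reasoning
  T = triangular m
  P = qPochInv m
  g = invOnePlus m
  convolved-summable : Summable (λ x → P ⊛ altWeightedPowers (suc m) x)
  convolved-summable x = ⊛-orderʳ P (altWeightedPowers (suc m) x) (altWeightedPowers-summable m x)

mid≗weightedPochSum : midSeries ≗ weightedPochSum 0
mid≗weightedPochSum = ≗-sym (≗-trans weightedPochSum-rows
                                     (≗-trans (Σ∞-swap middleEntry) (Σ∞-cong Σ∞-middleColumn)))

-- Partitions into distinct parts

sumOver-++ : ∀ πs ρs f → sumOver (πs ++ ρs) f ≡ sumOver πs f + sumOver ρs f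
sumOver-++ []       ρs f = sym (ℤₚ.+-identityˡ _)
sumOver-++ (π ∷ πs) ρs f = trans (cong (λ c → f π + c) (sumOver-++ πs ρs f)) (sym (ℤₚ.+-assoc (f π) _ _))

sumOver-map : ∀ (h : List ℕ → List ℕ) πs f → sumOver (map h πs) f ≡ sumOver πs (f ∘ h)
sumOver-map h []       f = refl
sumOver-map h (π ∷ πs) f = cong (λ c → f (h π) + c) (sumOver-map h πs f)

sumOver-cong : ∀ {P : List ℕ → Set} {πs f g} → All P πs → (∀ {π} → P π → f π ≡ g π) →
               sumOver πs f ≡ sumOver πs g
sumOver-cong []         f≡g = refl
sumOver-cong (pπ ∷ pπs) f≡g = cong₂ _+_ (f≡g pπ) (sumOver-cong pπs f≡g)

sumOver-ext : ∀ πs {f g} → (∀ π → f π ≡ g π) → sumOver πs f ≡ sumOver πs g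
sumOver-ext []       f≡g = refl
sumOver-ext (π ∷ πs) f≡g = cong₂ _+_ (f≡g π) (sumOver-ext πs f≡g)

sumOver-zero : ∀ πs f → (∀ π → f π ≡ 0ℤ) → sumOver πs f ≡ 0ℤ
sumOver-zero []       f f≡0 = refl
sumOver-zero (π ∷ πs) f f≡0 = cong₂ _+_ (f≡0 π) (sumOver-zero πs f f≡0)

sumOver-distrib-- : ∀ πs f g → sumOver πs (λ π → f π - g π) ≡ sumOver πs f - sumOver πs g
sumOver-distrib-- []       f g = refl
sumOver-distrib-- (π ∷ πs) f g =
  trans (cong (λ c → f π - g π + c) (sumOver-distrib-- πs f g)) (interchange (f π) (g π) _ _)
  where
  interchange : ∀ a b c d → (a - b) + (c - d) ≡ (a + c) - (b + d)
  interchange = solve-∀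

sumOver-filter : ∀ n πs f → sumOver (filter (λ π → listSum π ℕ.≟ n) πs) f ≡
                            sumOver πs (λ π → if does (listSum π ℕ.≟ n) then f π else 0ℤ)
sumOver-filter n []       f = refl
sumOver-filter n (π ∷ πs) f with does (listSum π ℕ.≟ n)
... | true  = cong (λ c → f π + c) (sumOver-filter n πs f)
... | false = trans (sumOver-filter n πs f) (sym (ℤₚ.+-identityˡ _))

weightAt : (List ℕ → ℤ) → ℕ → List ℕ → ℤ
weightAt w k π = if does (listSum π ℕ.≟ k) then w π else 0ℤ

weightedGF : (List ℕ → ℤ) → List (List ℕ) → FPS
weightedGF w πs k = sumOver πs (weightAt w k)

weightedGF-++ : ∀ w πs ρs → weightedGF w (πs ++ ρs) ≗ weightedGF w πs ⊕ weightedGF w ρs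
weightedGF-++ w πs ρs k = sumOver-++ πs ρs (weightAt w k)

weightedGF-cong : ∀ {P : List ℕ → Set} {w w′ πs} → All P πs → (∀ {π} → P π → w π ≡ w′ π) →
                  weightedGF w πs ≗ weightedGF w′ πs
weightedGF-cong {πs = πs} pπs w≡w′ k =
  sumOver-cong pπs (λ {π} pπ → cong (λ c → if does (listSum π ℕ.≟ k) then c else 0ℤ) (w≡w′ pπ))

weightedGF-⊖ : ∀ w w′ πs → weightedGF (λ π → w π - w′ π) πs ≗ weightedGF w πs ⊖ weightedGF w′ πs
weightedGF-⊖ w w′ πs k = trans (sumOver-ext πs (λ π → if-⊖ (does (listSum π ℕ.≟ k)) π))
                               (sumOver-distrib-- πs (weightAt w k) (weightAt w′ k))
  where
  if-⊖ : ∀ b π → (if b then w π - w′ π else 0ℤ) ≡ (if b then w π else 0ℤ) - (if b then w′ π else 0ℤ)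
  if-⊖ true  π = refl
  if-⊖ false π = refl

weightedGF-map-cons : ∀ w x πs → weightedGF w (map (x ∷_) πs) ≗ shift x (weightedGF (w ∘ (x ∷_)) πs)
weightedGF-map-cons w x πs k with k <? x
... | yes k<x = begin
  sumOver (map (x ∷_) πs) (weightAt w k)       ≡⟨ sumOver-map (x ∷_) πs (weightAt w k) ⟩
  sumOver πs (weightAt w k ∘ (x ∷_))           ≡⟨ sumOver-zero πs (weightAt w k ∘ (x ∷_)) vanish ⟩
  0ℤ                                           ≡⟨ sym (shift-< (weightedGF (w ∘ (x ∷_)) πs) k<x) ⟩
  shift x (weightedGF (w ∘ (x ∷_)) πs) k       ∎
  where
  open ≡-Reasoning
  vanish : ∀ π → weightAt w k (x ∷ π) ≡ 0ℤ
  vanish π = cong (λ b → if b then w (x ∷ π) else 0ℤ) (dec-false (x ℕ.+ listSum π ℕ.≟ k) too-large)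
    where
    too-large : x ℕ.+ listSum π ≢ k
    too-large eq = ℕₚ.<⇒≱ k<x (subst (x ≤_) eq (ℕₚ.m≤m+n x (listSum π)))
... | no k≮x = begin
  sumOver (map (x ∷_) πs) (weightAt w k)       ≡⟨ sumOver-map (x ∷_) πs (weightAt w k) ⟩
  sumOver πs (weightAt w k ∘ (x ∷_))           ≡⟨ sumOver-ext πs reindex ⟩
  sumOver πs (weightAt (w ∘ (x ∷_)) (k ∸ x))   ≡⟨ sym (shift-≥ (weightedGF (w ∘ (x ∷_)) πs) x≤k) ⟩
  shift x (weightedGF (w ∘ (x ∷_)) πs) k       ∎
  where
  open ≡-Reasoning
  x≤k = ℕₚ.≮⇒≥ k≮x
  reindex : ∀ π → weightAt w k (x ∷ π) ≡ weightAt (w ∘ (x ∷_)) (k ∸ x) π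
  reindex π = cong (λ b → if b then w (x ∷ π) else 0ℤ)
                   (does-⇔ (mk⇔ cancel uncancel) (x ℕ.+ listSum π ℕ.≟ k) (listSum π ℕ.≟ k ∸ x))
    where
    cancel : x ℕ.+ listSum π ≡ k → listSum π ≡ k ∸ x
    cancel eq = trans (sym (ℕₚ.m+n∸m≡n x (listSum π))) (cong (_∸ x) eq)
    uncancel : listSum π ≡ k ∸ x → x ℕ.+ listSum π ≡ k
    uncancel eq = trans (cong (x ℕ.+_) eq) (ℕₚ.m+[n∸m]≡n x≤k)

atEmpty : ℤ → List ℕ → ℤ
atEmpty c []      = c
atEmpty c (_ ∷ _) = 0ℤ

weightedGF-atEmpty : ∀ c xs → weightedGF (atEmpty c) (sublists xs) ≗ c · one
weightedGF-atEmpty c []       zero    = trans (ℤₚ.+-identityʳ c) (sym (ℤₚ.*-identityʳ c))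
weightedGF-atEmpty c []       (suc k) = sym (ℤₚ.*-zeroʳ c)
weightedGF-atEmpty c (y ∷ ys) k = begin
  weightedGF (atEmpty c) (map (y ∷_) (sublists ys) ++ sublists ys) k
    ≡⟨ weightedGF-++ (atEmpty c) (map (y ∷_) (sublists ys)) (sublists ys) k ⟩
  weightedGF (atEmpty c) (map (y ∷_) (sublists ys)) k + weightedGF (atEmpty c) (sublists ys) k
    ≡⟨ cong₂ _+_ (trans (sumOver-map (y ∷_) (sublists ys) (weightAt (atEmpty c) k))
                        (sumOver-zero (sublists ys) (weightAt (atEmpty c) k ∘ (y ∷_))
                                      (λ π → if-0 (does (y ℕ.+ listSum π ℕ.≟ k)))))
                 (weightedGF-atEmpty c ys k) ⟩
  0ℤ + c * one k
    ≡⟨ ℤₚ.+-identityˡ _ ⟩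
  c * one k ∎
  where
  open ≡-Reasoning
  if-0 : ∀ b → (if b then 0ℤ else 0ℤ) ≡ 0ℤ
  if-0 true  = refl
  if-0 false = refl

sublists-bounded : ∀ {b xs} → All (_< b) xs → All (All (_< b)) (sublists xs)
sublists-bounded []                      = [] ∷ []
sublists-bounded {xs = y ∷ ys} (y<b ∷ ys<b) =
  Allₚ.++⁺ (Allₚ.map⁺ (All.map (y<b ∷_) (sublists-bounded ys<b))) (sublists-bounded ys<b)

weight : List ℕ → ℤ
weight π = sign (#parts π ℕ.+ smallest π) * + smallest π

singletonGF : ℕ → FPS
singletonGF x = (sign (suc x) * + x) · shift x one

weight-cons : ∀ {x π} → All (_< x) π → weight (x ∷ π) ≡ atEmpty (sign (suc x) * + x) π - weight π
weight-cons {x} {[]}     []          = sym (ℤₚ.+-identityʳ (sign (suc x) * + x))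
weight-cons {x} {y ∷ ys} (y<x ∷ _)   = begin
  sign (suc (#parts (y ∷ ys)) ℕ.+ (x ℕ.⊓ s)) * + (x ℕ.⊓ s)
    ≡⟨ cong (λ m → sign (suc (#parts (y ∷ ys)) ℕ.+ m) * + m) x⊓s≡s ⟩
  (- sign (#parts (y ∷ ys) ℕ.+ s)) * + s
    ≡⟨ sym (ℤₚ.neg-distribˡ-* (sign (#parts (y ∷ ys) ℕ.+ s)) (+ s)) ⟩
  - weight (y ∷ ys)
    ≡⟨ sym (ℤₚ.+-identityˡ _) ⟩
  0ℤ - weight (y ∷ ys) ∎
  where
  open ≡-Reasoning
  s = smallest (y ∷ ys)
  s≤y : ∀ y ys → smallest (y ∷ ys) ≤ y
  s≤y y []       = ℕₚ.≤-refl
  s≤y y (_ ∷ _)  = ℕₚ.m⊓n≤m y _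
  x⊓s≡s : x ℕ.⊓ s ≡ s
  x⊓s≡s = ℕₚ.m≥n⇒m⊓n≡n (ℕₚ.≤-trans (s≤y y ys) (ℕₚ.<⇒≤ y<x))

sublistGF : List ℕ → FPS
sublistGF xs = weightedGF weight (sublists xs)

sublistGF-cons : ∀ {x xs} → All (_< x) xs →
                 sublistGF (x ∷ xs) ≗ sublistGF xs ⊖ shift x (sublistGF xs) ⊕ singletonGF x
sublistGF-cons {x} {xs} xs<x = begin
  weightedGF weight (map (x ∷_) (sublists xs) ++ sublists xs)
    ≈⟨ weightedGF-++ weight (map (x ∷_) (sublists xs)) (sublists xs) ⟩
  weightedGF weight (map (x ∷_) (sublists xs)) ⊕ G
    ≈⟨ ⊕-congʳ G (weightedGF-map-cons weight x (sublists xs)) ⟩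
  shift x (weightedGF (weight ∘ (x ∷_)) (sublists xs)) ⊕ G
    ≈⟨ ⊕-congʳ G (shift-congʳ x (≗-trans (weightedGF-cong (sublists-bounded xs<x) weight-cons)
                                (≗-trans (weightedGF-⊖ (atEmpty c) weight (sublists xs))
                                         (⊖-cong (weightedGF-atEmpty c xs) ≗-refl)))) ⟩
  shift x (c · one ⊖ G) ⊕ G
    ≈⟨ ⊕-congʳ G (≗-trans (shift-⊖ x (c · one) G) (⊖-cong (shift-· x c one) ≗-refl)) ⟩
  (singletonGF x ⊖ shift x G) ⊕ G
    ≈⟨ (λ k → rearrange (singletonGF x k) (shift x G k) (G k)) ⟩
  G ⊖ shift x G ⊕ singletonGF x ∎
  where
  open ≗-Reasoning
  c = sign (suc x) * + x
  G = sublistGF xs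
  rearrange : ∀ a b d → (a - b) + d ≡ d - b + a
  rearrange = solve-∀

distinctGF : ℕ → FPS
distinctGF n = sublistGF (map suc (downFrom n))

distinctGF-step : ∀ n → distinctGF (suc n) ≗ distinctGF n ⊛ oneMinus (+ 1) (suc n) ⊕ singletonGF (suc n)
distinctGF-step n = ≗-trans (sublistGF-cons parts<1+n)
  (⊕-congʳ (singletonGF (suc n)) (≗-sym (≗-trans (⊛-oneMinus (+ 1) n (distinctGF n))
                                                 (⊖-congˡ (distinctGF n) (·-identityˡ _)))))
  where
  parts<1+n : All (_< suc n) (map suc (downFrom n))
  parts<1+n = Allₚ.map⁺ (Allₚ.applyDownFrom⁺₁ _ n s≤s)

-- The left-hand series

lhs-distinctGF : ∀ k → lhsSeries k ≡ distinctGF k k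
lhs-distinctGF zero    = refl
lhs-distinctGF (suc k) = sumOver-filter (suc k) (sublists (map suc (downFrom (suc k)))) weight

weightedTail : ℕ → FPS
weightedTail = Σ∞-from (weightedPochTerm 0)

weightedPochTerm₀-order : ∀ x → weightedPochTerm 0 x ≈[< suc x ] 𝟘
weightedPochTerm₀-order x = ·-shift-order (sign x * + suc x) (suc x ℕ.* 1) (qPochFrom (suc x))
  (ℕₚ.≤-reflexive (sym (ℕₚ.*-identityʳ (suc x))))

weightedPochTerm-singleton : ∀ x → weightedPochTerm 0 x ≗ singletonGF (suc x) ⊛ qPochFrom (suc x)
weightedPochTerm-singleton x k = sym (begin
  (singletonGF (suc x) ⊛ qPochFrom (suc x)) k
    ≡⟨ ·-⊛ c (shift (suc x) one) (qPochFrom (suc x)) k ⟩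
  c * (shift (suc x) one ⊛ qPochFrom (suc x)) k
    ≡⟨ cong (c *_) (trans (shift-⊛ (suc x) one (qPochFrom (suc x)) k)
                          (shift-congʳ (suc x) (⊛-identityˡ (qPochFrom (suc x))) k)) ⟩
  c * shift (suc x) (qPochFrom (suc x)) k
    ≡⟨ cong₂ _*_ (cong (_* + suc x) (ℤₚ.neg-involutive (sign x)))
                 (shift-congˡ (qPochFrom (suc x)) (sym (ℕₚ.*-identityʳ (suc x))) k) ⟩
  weightedPochTerm 0 x k ∎)
  where
  open ≡-Reasoning
  c = sign (suc (suc x)) * + suc x

weightedPochSum-split : ∀ N → weightedPochSum 0 ≗ distinctGF N ⊛ qPochFrom N ⊕ weightedTail N
weightedPochSum-split zero k =
  sym (trans (cong (_+ weightedPochSum 0 k)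
                   (⊛-orderˡ (distinctGF 0) (qPochFrom 0) (λ i _ → distinctGF-0 i) k ℕₚ.≤-refl))
             (ℤₚ.+-identityˡ _))
  where
  distinctGF-0 : distinctGF 0 ≗ 𝟘
  distinctGF-0 zero    = refl
  distinctGF-0 (suc _) = refl
weightedPochSum-split (suc N) = begin
  weightedPochSum 0
    ≈⟨ weightedPochSum-split N ⟩
  distinctGF N ⊛ qPochFrom N ⊕ weightedTail N
    ≈⟨ ⊕-cong (⊛-congˡ (distinctGF N) (qPochFrom-unfold N)) (Σ∞-from-unfold weightedPochTerm₀-order N) ⟩
  distinctGF N ⊛ (ω ⊛ Q) ⊕ (weightedPochTerm 0 N ⊕ weightedTail (suc N))
    ≈⟨ ⊕-cong (≗-sym (⊛-assoc (distinctGF N) ω Q))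
              (⊕-congʳ (weightedTail (suc N)) (weightedPochTerm-singleton N)) ⟩
  (distinctGF N ⊛ ω) ⊛ Q ⊕ (singletonGF (suc N) ⊛ Q ⊕ weightedTail (suc N))
    ≈⟨ ≗-sym (⊕-assoc ((distinctGF N ⊛ ω) ⊛ Q) (singletonGF (suc N) ⊛ Q) (weightedTail (suc N))) ⟩
  ((distinctGF N ⊛ ω) ⊛ Q ⊕ singletonGF (suc N) ⊛ Q) ⊕ weightedTail (suc N)
    ≈⟨ ⊕-congʳ (weightedTail (suc N)) (≗-sym (⊛-distribʳ-⊕ (distinctGF N ⊛ ω) (singletonGF (suc N)) Q)) ⟩
  (distinctGF N ⊛ ω ⊕ singletonGF (suc N)) ⊛ Q ⊕ weightedTail (suc N)
    ≈⟨ ⊕-congʳ (weightedTail (suc N)) (⊛-congʳ Q (≗-sym (distinctGF-step N))) ⟩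
  distinctGF (suc N) ⊛ Q ⊕ weightedTail (suc N) ∎
  where
  open ≗-Reasoning
  ω = oneMinus (+ 1) (suc N)
  Q = qPochFrom (suc N)

lhs≗weightedPochSum : lhsSeries ≗ weightedPochSum 0
lhs≗weightedPochSum k = begin
  lhsSeries k
    ≡⟨ lhs-distinctGF k ⟩
  distinctGF k k
    ≡⟨ sym (⊛-identityʳ-below (distinctGF k) (qPochFrom k) (qPochFrom-≈1 k) k ℕₚ.≤-refl) ⟩
  (distinctGF k ⊛ qPochFrom k) k
    ≡⟨ sym (ℤₚ.+-identityʳ _) ⟩
  (distinctGF k ⊛ qPochFrom k) k + 0ℤ
    ≡⟨ cong (λ c → (distinctGF k ⊛ qPochFrom k) k + c)
            (sym (Σ∞-from-order weightedPochTerm₀-order k k ℕₚ.≤-refl)) ⟩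
  (distinctGF k ⊛ qPochFrom k ⊕ weightedTail k) k
    ≡⟨ sym (weightedPochSum-split k k) ⟩
  weightedPochSum 0 k ∎
  where open ≡-Reasoning

corollary3p10 : ((k : ℕ) → lhsSeries k ≡ midSeries k) × ((k : ℕ) → midSeries k ≡ rhsSeries k)
corollary3p10 = (λ k → trans (lhs≗weightedPochSum k) (sym (mid≗weightedPochSum k)))
              , (λ k → trans (mid≗weightedPochSum k) (sym (rhs≗weightedPochSum k)))
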